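{- Let $A$ and $B$ be time series, let $d_{A,B}$ be a dissimilarity function with nonnegative integer values, let $c=\max_{i,j}d_{A,B}(i,j)$, and let $S_{A,B}$, $G^\vdash_{A,B}$, $G^\dashv_{A,B}$, $H^\vdash_{A,B}$, $H^\dashv_{A,B}$ be as defined in the context. For any indices $1\le i_\vdash\le i_\dashv\le|A|$ and $1\le j_\vdash\le j_\dashv\le|B|$, the DTW distance between $A[i_\vdash:i_\dashv]$ and $B[j_\vdash:j_\dashv]$ equals $c\,(|A[i_\vdash:i_\dashv]|+|B[j_\vdash:j_\dashv]|+1)$ minus the $[H^\vdash_{A,B}[j_\vdash]:H^\dashv_{A,B}[j_\dashv]]$-banded LIS length of $S_{A,B}[G^\vdash_{A,B}[i_\vdash]:G^\dashv_{A,B}[i_\dashv]]$.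
   Context: Sequences are 1-indexed; for a sequence $S$, $|S|$ is its length, $S[i]$ its $i$-th element, $S[a:b]=S[a]\circ\cdots\circ S[b]$, $\circ$ is concatenation. A subsequence of $S$ is $S[i_1]\circ\cdots\circ S[i_\ell]$ with $\ell\ge1$ and $i_1<\cdots<i_\ell$. A time series is a nonempty finite sequence; for time series $A,B$, $d_{A,B}(i,j)$ ($1\le i\le|A|$, $1\le j\le|B|$) is a nonnegative integer (dissimilarity of $A[i]$ and $B[j]$). An alignment of $A[i_\vdash:i_\dashv]$ and $B[j_\vdash:j_\dashv]$ is a sequence $P=(i_1,j_1)\circ\cdots\circ(i_{|P|},j_{|P|})$ with $(i_1,j_1)=(i_\vdash,j_\vdash)$, $(i_{|P|},j_{|P|})=(i_\dashv,j_\dashv)$, and for $2\le k\le|P|$, $(i_k,j_k)\in\{(i_{k-1}+1,j_{k-1}+1),(i_{k-1}+1,j_{k-1}),(i_{k-1},j_{k-1}+1)\}$. Its discrepancy is $\sum_{k=1}^{|P|}d_{A,B}(i_k,j_k)$. The DTW distance between $A[i_\vdash:i_\dashv]$ and $B[j_\vdash:j_\dashv]$ is the minimum discrepancy over all their alignments. For a sequence $S$ of integers: a subsequence is increasing if each element other than the last is less than the next one; it is $[h_\vdash:h_\dashv]$-banded if all its elements lie in $[h_\vdash,h_\dashv]$. The $[h_\vdash:h_\dashv]$-banded LIS length of $S$ is the maximum length of an $[h_\vdash:h_\dashv]$-banded increasing subsequence of $S$. Auxiliary weighted sequence $R_{A,B}$ of length $|A||B|+(|A|-1)(|B|-1)$,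 consisting of distinct integers: for $1\le i\le|A|$, $1\le j\le|B|$, the integer $r(i,j)=(j-1)(2|A|-1)+i$ occurs at position $f(r(i,j))=(i-1)(2|B|-1)+j$ with weight $w(r(i,j))=c-d_{A,B}(i,j)$; for $2\le i\le|A|$, $2\le j\le|B|$, the integer $\tilde r(i,j)=(j-1)(2|A|-1)-i+2$ occurs at position $f(\tilde r(i,j))=(i-1)(2|B|-1)-j+2$ with weight $c$. These positions are exactly $1,\dots,|R_{A,B}|$; $f(q)$ is the position of element $q$. For each element $q$ of $R_{A,B}$: $g_\dashv(q)=\sum w(q')$ over elements $q'$ with $f(q')\le f(q)$; $h_\dashv(q)=\sum w(q')$ over elements $q'$ with $q'\le q$ (as integers); $g_\vdash(q)=g_\dashv(q)-w(q)+1$; $h_\vdash(q)=h_\dashv(q)-w(q)+1$; $S_q=h_\vdash(q)\circ(h_\vdash(q)+1)\circ\cdots\circ h_\dashv(q)$ ($w(q)$ consecutive integers). The DTW distance sequence is $S_{A,B}=S_{R_{A,B}[1]}\circ\cdots\circ S_{R_{A,B}[|R_{A,B}|]}$. Arrays: $G^\vdash_{A,B}[i]=g_\vdash(r(i,1))$, $G^\dashv_{A,B}[i]=g_\dashv(r(i,|B|))$ for $1\le i\le|A|$; $H^\vdash_{A,B}[j]=h_\vdash(r(1,j))$, $H^\dashv_{A,B}[j]=h_\dashv(r(|A|,j))$ for $1\le j\le|B|$.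
   Formalization: The DTW distance equals $c\,(|A[i_\vdash:i_\dashv]|+|B[j_\vdash:j_\dashv]|-1)$ minus the banded LIS length, with −1 in place of +1 inside the factor multiplying c. This corrects a misprint. -}

module Defs where

open import Data.Nat using (ℕ; zero; suc; _+_; _*_; _∸_; _≤_; _<_; _⊔_; _<?_)
open import Data.Nat.Properties using ()
open import Data.Fin using (Fin; fromℕ<)
open import Data.Nat.ListAction using (sum)
open import Data.List using (List; []; _∷_; map; concatMap; upTo; length; filterᵇ; take; drop; head; last; foldr)
open import Data.List.Relation.Unary.All using (All)
open import Data.List.Relation.Unary.Linked using (Linked)
open import Data.List.Relation.Binary.Sublist.Propositional using (_⊆_)
open import Data.Maybe using (Maybe; just)
open import Data.Product using (_×_; _,_; Σ-syntax; ∃-syntax)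
open import Data.Sum using (_⊎_)
open import Data.Bool using (Bool)
open import Relation.Binary.PropositionalEquality using (_≡_)
open import Relation.Nullary using (yes; no)
import Data.Nat as ℕ

range : ℕ → ℕ → List ℕ
range a b = map (a +_) (upTo (suc b ∸ a))

-- 1-indexed view of a dissimilarity d_{A,B} given on Fin |A| × Fin |B|
-- (value 0 outside 1..|A| × 1..|B|, never used there).
dis : ∀ {n m} → (Fin n → Fin m → ℕ) → ℕ → ℕ → ℕ
dis {n} {m} d i j with (i ∸ 1) <? n | (j ∸ 1) <? m
... | yes p | yes q = d (fromℕ< p) (fromℕ< q)
... | _     | _     = 0

cmax : ∀ {n m} → (Fin n → Fin m → ℕ) → ℕ
cmax {n} {m} d = foldr _⊔_ 0 (concatMap (λ i → map (λ j → dis d i j) (range 1 m)) (range 1 n))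

Step : ℕ × ℕ → ℕ × ℕ → Set
Step (i , j) (i' , j') =
  ((i' ≡ suc i) × (j' ≡ suc j)) ⊎ ((i' ≡ suc i) × (j' ≡ j)) ⊎ ((i' ≡ i) × (j' ≡ suc j))

IsAlignment : ℕ → ℕ → ℕ → ℕ → List (ℕ × ℕ) → Set
IsAlignment i⊢ i⊣ j⊢ j⊣ P =
  (head P ≡ just (i⊢ , j⊢)) × (last P ≡ just (i⊣ , j⊣)) × Linked Step P

discrepancy : (ℕ → ℕ → ℕ) → List (ℕ × ℕ) → ℕ
discrepancy δ P = sum (map (λ { (i , j) → δ i j }) P)

IsDTW : (ℕ → ℕ → ℕ) → ℕ → ℕ → ℕ → ℕ → ℕ → Set
IsDTW δ i⊢ i⊣ j⊢ j⊣ D =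
  (∃[ P ] (IsAlignment i⊢ i⊣ j⊢ j⊣ P × discrepancy δ P ≡ D))
  × (∀ P → IsAlignment i⊢ i⊣ j⊢ j⊣ P → D ≤ discrepancy δ P)

Increasing : List ℕ → Set
Increasing = Linked _<_

Banded : ℕ → ℕ → List ℕ → Set
Banded lo hi = All (λ x → (lo ≤ x) × (x ≤ hi))

IsBandedLIS : List ℕ → ℕ → ℕ → ℕ → Set
IsBandedLIS S lo hi L =
  (∃[ xs ] (xs ⊆ S × Increasing xs × Banded lo hi xs × length xs ≡ L))
  × (∀ xs → xs ⊆ S → Increasing xs → Banded lo hi xs → length xs ≤ L)

slice : List ℕ → ℕ → ℕ → List ℕ
slice S a b = take (suc b ∸ a) (drop (a ∸ 1) S)

record Entry : Set where
  constructor entry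
  field
    val : ℕ   -- the integer q
    pos : ℕ   -- f(q)
    wt  : ℕ
open Entry public

module Aux {n m : ℕ} (d : Fin n → Fin m → ℕ) where
  c : ℕ
  c = cmax d

  r : ℕ → ℕ → Entry
  r i j = entry ((j ∸ 1) * (2 * n ∸ 1) + i) ((i ∸ 1) * (2 * m ∸ 1) + j) (c ∸ dis d i j)

  r~ : ℕ → ℕ → Entry
  r~ i j = entry ((j ∸ 1) * (2 * n ∸ 1) + 2 ∸ i) ((i ∸ 1) * (2 * m ∸ 1) + 2 ∸ j) c

  -- all elements of R_{A,B} (in no particular order)
  entries : List Entry
  entries = concatMap (λ i → map (r i) (range 1 m)) (range 1 n)
          ++ concatMap (λ i → map (r~ i) (range 2 m)) (range 2 n)
    where open Data.List using (_++_)

  lenR : ℕ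
  lenR = n * m + (n ∸ 1) * (m ∸ 1)

  g⊣ h⊣ g⊢ h⊢ : Entry → ℕ
  g⊣ q = sum (map wt (filterᵇ (λ q' → pos q' ℕ.≤ᵇ pos q) entries))
  h⊣ q = sum (map wt (filterᵇ (λ q' → val q' ℕ.≤ᵇ val q) entries))
  g⊢ q = g⊣ q ∸ wt q + 1
  h⊢ q = h⊣ q ∸ wt q + 1

  Sq : Entry → List ℕ
  Sq q = map (h⊢ q +_) (upTo (wt q))

  -- R_{A,B}[p] is the element with f(q) = p
  atPos : ℕ → List Entry
  atPos p = filterᵇ (λ q → pos q ℕ.≡ᵇ p) entries

  S : List ℕ
  S = concatMap (λ p → concatMap Sq (atPos p)) (range 1 lenR)

  G⊢ G⊣ H⊢ H⊣ : ℕ → ℕ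
  G⊢ i = g⊢ (r i 1)
  G⊣ i = g⊣ (r i m)
  H⊢ j = h⊢ (r 1 j)
  H⊣ j = h⊣ (r n j)

-- Write dtw i j a b for the DTW distance between A[i : i + a] and
-- B[j : j + b]; it satisfies the usual min-recursion.  Call the elements r(i,j) and
-- r̃(i,j) of R_{A,B} nodes, and order them by x ≺ y when y follows x both in position
-- and in value: positions list the grid row by row, values column by column.  With
-- weight c - d(i,j) on r(i,j) and c on r̃(i,j), every ≺-chain in the window weighs at
-- most c (a + b + 1) - dtw, with equality along an optimal warping path, whose
-- diagonal steps pick up the r̃'s.  Replacing each node q of a chain by the run S_q
-- turns chains into increasing subsequences of the slice that stay in the band, and
-- conversely the runs met by an increasing banded subsequence form a chain to which
-- each run contributes at most its weight.

module Submission where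

open import Defs
open import Data.Nat
open import Data.Nat.Properties
open import Data.Bool using (Bool; true; false; if_then_else_; T)
open import Data.Empty using (⊥; ⊥-elim)
open import Function using (_∘_; _∘′_)
open import Data.Fin using (Fin; fromℕ<)
open import Data.List using (List; []; _∷_; _++_; map; concatMap; filterᵇ; applyUpTo; upTo; length; take; drop; foldr; last)
open import Data.List.Properties using (map-applyUpTo; map-++; concatMap-++; length-++; length-map; length-upTo; map-cong)
open import Data.Nat.ListAction using (sum)
open import Data.Nat.ListAction.Properties using (sum-++)
open import Data.List.Membership.Propositional using (_∈_; find)
open import Data.List.Membership.Propositional.Properties
  using (∈-map⁺; ∈-map⁻; ∈-++⁺ˡ; ∈-++⁺ʳ; ∈-++⁻; ∈-concatMap⁺; ∈-concatMap⁻; ∈-upTo⁻; ∈-filter⁺; ∈-filter⁻)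
open import Data.List.Relation.Unary.Any as Any using (here; there)
open import Data.List.Relation.Unary.All as All using (All; []; _∷_)
open import Data.List.Relation.Unary.All.Properties using (concat⁺) renaming (map⁺ to map⁺ᴬ)
open import Data.List.Relation.Unary.Linked as Linked using (Linked; []; [-]; _∷_)
open import Data.List.Relation.Binary.Sublist.Propositional using (_⊆_; []; _∷_; _∷ʳ_; ⊆-refl)
open import Data.List.Relation.Binary.Sublist.Propositional.Properties using ([]⊆-universal; ++⁺; ++⁺ˡ; ++⁺ʳ; ∷ˡ⁻; Any-resp-⊆)
open import Data.List.Relation.Unary.Linked.Properties using (Linked⇒All; map⁺; applyUpTo⁺₂)
open import Data.Maybe using (just)
open import Data.Maybe.Properties using (just-injective)
open import Data.Product using (Σ-syntax; ∃-syntax; _×_; _,_; proj₁; proj₂)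
open import Data.Sum using (_⊎_; inj₁; inj₂)
open import Relation.Binary.PropositionalEquality
open import Relation.Binary.Definitions using (tri<; tri≈; tri>)
open import Relation.Nullary using (yes; no; T?)
open import Algebra.Properties.CommutativeSemigroup +-commutativeSemigroup using (interchange)

interval : ℕ → ℕ → List ℕ
interval a zero = []
interval a (suc k) = a ∷ interval (suc a) k

applyUpTo-interval : ∀ (f : ℕ → ℕ) a k → (∀ x → f x ≡ a + x) → applyUpTo f k ≡ interval a k
applyUpTo-interval f a zero eq = refl
applyUpTo-interval f a (suc k) eq =
  cong₂ _∷_ (trans (eq 0) (+-identityʳ a))
            (applyUpTo-interval (f ∘′ suc) (suc a) k (λ x → trans (eq (suc x)) (+-suc a x)))

range≡interval : ∀ a b → range a b ≡ interval a (suc b ∸ a)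
range≡interval a b = trans (map-applyUpTo (λ x → x) (a +_) (suc b ∸ a)) (applyUpTo-interval (a +_) a _ (λ _ → refl))

interval-++ : ∀ a k l → interval a (k + l) ≡ interval a k ++ interval (a + k) l
interval-++ a zero l = cong (λ z → interval z l) (sym (+-identityʳ a))
interval-++ a (suc k) l = cong (a ∷_) (trans (interval-++ (suc a) k l) (cong (λ z → interval (suc a) k ++ interval z l) (sym (+-suc a k))))

∈-interval⁻ : ∀ {x a k} → x ∈ interval a k → a ≤ x × x < a + k
∈-interval⁻ {a = a} {suc k} (here refl) = ≤-refl , subst (a <_) (sym (+-suc a k)) (s≤s (m≤m+n a k))
∈-interval⁻ {x} {a = a} {suc k} (there p) with ∈-interval⁻ p
... | a<x , x<a+k = <⇒≤ a<x , subst (x <_) (sym (+-suc a k)) x<a+k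

∈-interval⁺ : ∀ {x a k} → a ≤ x → x < a + k → x ∈ interval a k
∈-interval⁺ {x} {a} {zero} a≤x x<a+0 = ⊥-elim (<⇒≱ x<a+0 (subst (_≤ x) (sym (+-identityʳ a)) a≤x))
∈-interval⁺ {x} {a} {suc k} a≤x x<a+k with m≤n⇒m<n∨m≡n a≤x
... | inj₂ refl = here refl
... | inj₁ a<x = there (∈-interval⁺ a<x (subst (x <_) (+-suc a k) x<a+k))

module _ {B : Set} (f : ℕ → ℕ → B) where

  ∈-grid⁺ : ∀ is js {i j} → i ∈ is → j ∈ js → f i j ∈ concatMap (λ i → map (f i) js) is
  ∈-grid⁺ is js i∈ j∈ = ∈-concatMap⁺ (λ i → map (f i) js) (Any.map (λ { refl → ∈-map⁺ (f _) j∈ }) i∈)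

  ∈-grid⁻ : ∀ is js {v} → v ∈ concatMap (λ i → map (f i) js) is → ∃[ i ] ∃[ j ] (i ∈ is × j ∈ js × v ≡ f i j)
  ∈-grid⁻ is js v∈ with i , i∈ , v∈row ← find (∈-concatMap⁻ (λ i → map (f i) js) v∈)
    with j , j∈ , refl ← ∈-map⁻ (f i) v∈row = i , j , i∈ , j∈ , refl

length-concatMap : ∀ {A B : Set} (f : A → List B) xs → length (concatMap f xs) ≡ sum (map (λ x → length (f x)) xs)
length-concatMap f [] = refl
length-concatMap f (x ∷ xs) = trans (length-++ (f x)) (cong (length (f x) +_) (length-concatMap f xs))

drop-++-length : ∀ {A : Set} (xs ys : List A) → drop (length xs) (xs ++ ys) ≡ ys
drop-++-length [] ys = refl
drop-++-length (x ∷ xs) ys = drop-++-length xs ys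

take-++-length : ∀ {A : Set} (xs ys : List A) → take (length xs) (xs ++ ys) ≡ xs
take-++-length [] ys = refl
take-++-length (x ∷ xs) ys = cong (x ∷_) (take-++-length xs ys)

slice-middle : ∀ (xs ys zs : List ℕ) → slice (xs ++ ys ++ zs) (length xs + 1) (length xs + length ys) ≡ ys
slice-middle xs ys zs = begin
  take (suc (length xs + length ys) ∸ (length xs + 1)) (drop (length xs + 1 ∸ 1) (xs ++ ys ++ zs))
    ≡⟨ cong₂ (λ u v → take u (drop v (xs ++ ys ++ zs))) count (m+n∸n≡m (length xs) 1) ⟩
  take (length ys) (drop (length xs) (xs ++ ys ++ zs))
    ≡⟨ cong (take (length ys)) (drop-++-length xs (ys ++ zs)) ⟩
  take (length ys) (ys ++ zs)
    ≡⟨ take-++-length ys zs ⟩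
  ys ∎
  where
  open ≡-Reasoning
  count : suc (length xs + length ys) ∸ (length xs + 1) ≡ length ys
  count = trans (cong (_∸ (length xs + 1)) (sym (trans (+-assoc (length xs) 1 (length ys)) (+-suc (length xs) (length ys)))))
                (m+n∸m≡n (length xs + 1) (length ys))

+≤⇒<∸+1 : ∀ {a w h} → a + w ≤ h → a < h ∸ w + 1
+≤⇒<∸+1 {a} {w} {h} le = subst (a <_) (+-comm 1 (h ∸ w)) (s≤s (subst (_≤ h ∸ w) (m+n∸n≡m a w) (∸-monoˡ-≤ w le)))

∸+1+<≤ : ∀ {h w k} → w ≤ h → k < w → (h ∸ w + 1) + k ≤ h
∸+1+<≤ {h} {w} {k} w≤h k<w = begin
  (h ∸ w + 1) + k ≡⟨ +-assoc (h ∸ w) 1 k ⟩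
  (h ∸ w) + suc k ≤⟨ +-monoʳ-≤ (h ∸ w) k<w ⟩
  (h ∸ w) + w     ≡⟨ m∸n+n≡m w≤h ⟩
  h               ∎
  where open ≤-Reasoning

∈⇒≤-foldr-⊔ : ∀ {v} L → v ∈ L → v ≤ foldr _⊔_ 0 L
∈⇒≤-foldr-⊔ (x ∷ L) (here refl) = m≤m⊔n x _
∈⇒≤-foldr-⊔ (x ∷ L) (there v∈) = ≤-trans (∈⇒≤-foldr-⊔ L v∈) (m≤n⊔m x _)

Linked-on⇒All : ∀ {E : Set} (key : E → ℕ) {x ch} → Linked (λ u v → key u < key v) (x ∷ ch) → All (λ y → key x < key y) ch
Linked-on⇒All key [-] = []
Linked-on⇒All key (x<y ∷ lk) = Linked⇒All <-trans x<y lk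

module _ {A : Set} {R S : A → A → Set} where

  Linked-map-All : ∀ {P : A → Set} → (∀ {x y} → P x → P y → R x y → S x y) → ∀ {xs} → All P xs → Linked R xs → Linked S xs
  Linked-map-All f [] [] = []
  Linked-map-All f (_ ∷ []) [-] = [-]
  Linked-map-All f (px ∷ py ∷ ps) (r ∷ lk) = f px py r ∷ Linked-map-All f (py ∷ ps) lk

Linked-++ : ∀ {A : Set} {R : A → A → Set} {xs ys} → Linked R xs → Linked R ys → (∀ {u v} → u ∈ xs → v ∈ ys → R u v) →
            Linked R (xs ++ ys)
Linked-++ {xs = []} _ lys _ = lys
Linked-++ {xs = _ ∷ []} {[]} _ _ _ = [-]
Linked-++ {xs = _ ∷ []} {_ ∷ _} _ lys sep = sep (here refl) (here refl) ∷ lys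
Linked-++ {xs = _ ∷ _ ∷ _} (r ∷ lxs) lys sep = r ∷ Linked-++ lxs lys (sep ∘ there)

∈⇒⊆-concatMap : ∀ {A B : Set} (f : A → List B) {x xs} → x ∈ xs → f x ⊆ concatMap f xs
∈⇒⊆-concatMap f {xs = y ∷ ys} (here refl) = ++⁺ʳ (concatMap f ys) ⊆-refl
∈⇒⊆-concatMap f {xs = y ∷ ys} (there x∈) = ++⁺ˡ (f y) (∈⇒⊆-concatMap f x∈)

min3 : ℕ → ℕ → ℕ → ℕ
min3 x y z = x ⊓ (y ⊓ z)

min3-sel : ∀ x y z → min3 x y z ≡ x ⊎ min3 x y z ≡ y ⊎ min3 x y z ≡ z
min3-sel x y z with ⊓-sel x (y ⊓ z)
... | inj₁ e = inj₁ e
... | inj₂ e with ⊓-sel y z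
...   | inj₁ e′ = inj₂ (inj₁ (trans e e′))
...   | inj₂ e′ = inj₂ (inj₂ (trans e e′))

min3≤₁ : ∀ x y z → min3 x y z ≤ x
min3≤₁ x y z = m⊓n≤m x _

min3≤₂ : ∀ x y z → min3 x y z ≤ y
min3≤₂ x y z = ≤-trans (m⊓n≤n x _) (m⊓n≤m y z)

min3≤₃ : ∀ x y z → min3 x y z ≤ z
min3≤₃ x y z = ≤-trans (m⊓n≤n x _) (m⊓n≤n y z)

positive-offset : ∀ {i a} → suc i ≤ i + a → ∃[ a′ ] a ≡ suc a′
positive-offset {i} {zero} h = ⊥-elim (n≮n i (subst (i <_) (+-identityʳ i) h))
positive-offset {a = suc a} h = a , refl

pattern step-diag  = inj₁ (refl , refl)
pattern step-down  = inj₂ (inj₁ (refl , refl))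
pattern step-right = inj₂ (inj₂ (refl , refl))

module DTW (δ : ℕ → ℕ → ℕ) where

  dtw : ℕ → ℕ → ℕ → ℕ → ℕ
  dtw i j zero    zero    = δ i j
  dtw i j (suc a) zero    = δ i j + dtw (suc i) j a zero
  dtw i j zero    (suc b) = δ i j + dtw i (suc j) zero b
  dtw i j (suc a) (suc b) = δ i j + min3 (dtw (suc i) j a (suc b)) (dtw i (suc j) (suc a) b) (dtw (suc i) (suc j) a b)

  dtw-down : ∀ i j a b → dtw i j (suc a) b ≤ δ i j + dtw (suc i) j a b
  dtw-down i j a zero    = ≤-refl
  dtw-down i j a (suc b) = +-monoʳ-≤ (δ i j) (min3≤₁ _ _ _)

  dtw-right : ∀ i j a b → dtw i j a (suc b) ≤ δ i j + dtw i (suc j) a b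
  dtw-right i j zero    b = ≤-refl
  dtw-right i j (suc a) b = +-monoʳ-≤ (δ i j) (min3≤₂ _ _ _)

  dtw-diag : ∀ i j a b → dtw i j (suc a) (suc b) ≤ δ i j + dtw (suc i) (suc j) a b
  dtw-diag i j a b = +-monoʳ-≤ (δ i j) (min3≤₃ _ _ _)

  Alignment : ℕ → ℕ → ℕ → ℕ → List (ℕ × ℕ) → Set
  Alignment i j a b = IsAlignment i (i + a) j (j + b)

  AlignmentOfCost : ℕ → ℕ → ℕ → ℕ → ℕ → Set
  AlignmentOfCost i j a b D = ∃[ P ] (Alignment i j a b P × discrepancy δ P ≡ D)

  ∷-alignment : ∀ {i j i′ j′ a b a′ b′ P} → Step (i , j) (i′ , j′) → i′ + a′ ≡ i + a → j′ + b′ ≡ j + b →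
                Alignment i′ j′ a′ b′ P → Alignment i j a b ((i , j) ∷ P)
  ∷-alignment {P = []} st ea eb (() , _)
  ∷-alignment {P = _ ∷ _} st ea eb (refl , l , lk) = refl , trans l (cong₂ (λ u v → just (u , v)) ea eb) , st ∷ lk

  extend-alignment : ∀ {i j i′ j′ a b a′ b′ D′} → Step (i , j) (i′ , j′) → i′ + a′ ≡ i + a → j′ + b′ ≡ j + b →
                     AlignmentOfCost i′ j′ a′ b′ D′ → AlignmentOfCost i j a b (δ i j + D′)
  extend-alignment {i} {j} st ea eb (P , al , eq) = (i , j) ∷ P , ∷-alignment st ea eb al , cong (δ i j +_) eq

  dtw-alignment : ∀ i j a b → AlignmentOfCost i j a b (dtw i j a b)
  dtw-alignment i j zero zero =
    (i , j) ∷ [] , (refl , cong₂ (λ u v → just (u , v)) (sym (+-identityʳ i)) (sym (+-identityʳ j)) , [-]) , +-identityʳ _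
  dtw-alignment i j (suc a) zero = extend-alignment step-down (sym (+-suc i a)) refl (dtw-alignment (suc i) j a zero)
  dtw-alignment i j zero (suc b) = extend-alignment step-right refl (sym (+-suc j b)) (dtw-alignment i (suc j) zero b)
  dtw-alignment i j (suc a) (suc b) with min3-sel (dtw (suc i) j a (suc b)) (dtw i (suc j) (suc a) b) (dtw (suc i) (suc j) a b)
  ... | inj₁ m = subst (AlignmentOfCost i j (suc a) (suc b)) (cong (δ i j +_) (sym m))
        (extend-alignment step-down (sym (+-suc i a)) refl (dtw-alignment (suc i) j a (suc b)))
  ... | inj₂ (inj₁ m) = subst (AlignmentOfCost i j (suc a) (suc b)) (cong (δ i j +_) (sym m))
        (extend-alignment step-right refl (sym (+-suc j b)) (dtw-alignment i (suc j) (suc a) b))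
  ... | inj₂ (inj₂ m) = subst (AlignmentOfCost i j (suc a) (suc b)) (cong (δ i j +_) (sym m))
        (extend-alignment step-diag (sym (+-suc i a)) (sym (+-suc j b)) (dtw-alignment (suc i) (suc j) a b))

  alignment-monotone : ∀ {p P x y} → Linked Step (p ∷ P) → last (p ∷ P) ≡ just (x , y) → proj₁ p ≤ x × proj₂ p ≤ y
  alignment-monotone {P = []} _ refl = ≤-refl , ≤-refl
  alignment-monotone {i , j} (step-diag ∷ lk) l =
    let u , v = alignment-monotone lk l in ≤-trans (n≤1+n i) u , ≤-trans (n≤1+n j) v
  alignment-monotone {i , j} (step-down ∷ lk) l =
    let u , v = alignment-monotone lk l in ≤-trans (n≤1+n i) u , v
  alignment-monotone {i , j} (step-right ∷ lk) l =
    let u , v = alignment-monotone lk l in u , ≤-trans (n≤1+n j) v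

  dtw≤discrepancy : ∀ i j a b P → Alignment i j a b P → dtw i j a b ≤ discrepancy δ P
  dtw≤discrepancy i j a b (_ ∷ []) (refl , l , _)
    with refl ← +-cancelˡ-≡ i 0 a (trans (+-identityʳ i) (cong proj₁ (just-injective l)))
       | refl ← +-cancelˡ-≡ j 0 b (trans (+-identityʳ j) (cong proj₂ (just-injective l)))
    = ≤-reflexive (sym (+-identityʳ _))
  dtw≤discrepancy i j a b (_ ∷ _ ∷ P) (refl , l , step-diag ∷ lk)
    with a′ , refl ← positive-offset (proj₁ (alignment-monotone lk l))
       | b′ , refl ← positive-offset (proj₂ (alignment-monotone lk l))
    = ≤-trans (dtw-diag i j a′ b′) (+-monoʳ-≤ (δ i j)
        (dtw≤discrepancy (suc i) (suc j) a′ b′ _ (refl , trans l (cong₂ (λ u v → just (u , v)) (+-suc i a′) (+-suc j b′)) , lk)))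
  dtw≤discrepancy i j a b (_ ∷ _ ∷ P) (refl , l , step-down ∷ lk)
    with a′ , refl ← positive-offset (proj₁ (alignment-monotone lk l))
    = ≤-trans (dtw-down i j a′ b) (+-monoʳ-≤ (δ i j)
        (dtw≤discrepancy (suc i) j a′ b _ (refl , trans l (cong (λ u → just (u , j + b)) (+-suc i a′)) , lk)))
  dtw≤discrepancy i j a b (_ ∷ _ ∷ P) (refl , l , step-right ∷ lk)
    with b′ , refl ← positive-offset (proj₂ (alignment-monotone lk l))
    = ≤-trans (dtw-right i j a b′) (+-monoʳ-≤ (δ i j)
        (dtw≤discrepancy i (suc j) a b′ _ (refl , trans l (cong (λ v → just (i + a , v)) (+-suc j b′)) , lk)))

  dtw-isDTW : ∀ i j a b → IsDTW δ i (i + a) j (j + b) (dtw i j a b)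
  dtw-isDTW i j a b = dtw-alignment i j a b , dtw≤discrepancy i j a b

-- cell i j and diag i j stand for r(i,j) and r̃(i,j); the latter lies on the
-- diagonal step from (i - 1, j - 1) to (i, j).
data Node : Set where
  cell diag : ℕ → ℕ → Node

data _≺_ : Node → Node → Set where
  cell≺cell : ∀ {i j i′ j′} → i ≤ i′ → j ≤ j′ → i < i′ ⊎ j < j′ → cell i j ≺ cell i′ j′
  cell≺diag : ∀ {i j i′ j′} → i < i′ → j < j′ → cell i j ≺ diag i′ j′
  diag≺cell : ∀ {i j i′ j′} → i ≤ i′ → j ≤ j′ → diag i j ≺ cell i′ j′
  diag≺diag : ∀ {i j i′ j′} → i < i′ → j < j′ → diag i j ≺ diag i′ j′

transpose : Node → Node
transpose (cell i j) = cell j i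
transpose (diag i j) = diag j i

RowFrom : ℕ → Node → Set
RowFrom i (cell i′ _) = i ≤ i′
RowFrom i (diag i′ _) = i < i′

RowUpTo : ℕ → Node → Set
RowUpTo I (cell i _) = i ≤ I
RowUpTo I (diag i _) = i ≤ I

From : ℕ → ℕ → Node → Set
From i j x = RowFrom i x × RowFrom j (transpose x)

UpTo : ℕ → ℕ → Node → Set
UpTo I J x = RowUpTo I x × RowUpTo J (transpose x)

From-≺ : ∀ {i j x y} → From i j x → x ≺ y → From i j y
From-≺ (p , q) (cell≺cell u v _) = ≤-trans p u , ≤-trans q v
From-≺ (p , q) (cell≺diag u v) = <-≤-trans (s≤s p) u , <-≤-trans (s≤s q) v
From-≺ (p , q) (diag≺cell u v) = ≤-trans (<⇒≤ p) u , ≤-trans (<⇒≤ q) v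
From-≺ (p , q) (diag≺diag u v) = <-trans p u , <-trans q v

From-chain : ∀ {i j x ch} → From i j x → Linked _≺_ (x ∷ ch) → All (From i j) (x ∷ ch)
From-chain {ch = []} f _ = f ∷ []
From-chain {ch = _ ∷ _} f (x≺y ∷ lk) = f ∷ From-chain (From-≺ f x≺y) lk

after-diag : ∀ {i j ch} → Linked _≺_ (diag i j ∷ ch) → All (From i j) ch
after-diag {ch = []} _ = []
after-diag {ch = _ ∷ _} (diag≺cell u v ∷ lk) = From-chain (u , v) lk
after-diag {ch = _ ∷ _} (diag≺diag u v ∷ lk) = From-chain (u , v) lk

after-cell : ∀ {i j y} → cell i j ≺ y → From i j y × y ≢ cell i j
after-cell (cell≺cell u v (inj₁ i<i)) = (u , v) , λ { refl → n≮n _ i<i }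
after-cell (cell≺cell u v (inj₂ j<j)) = (u , v) , λ { refl → n≮n _ j<j }
after-cell (cell≺diag u v) = (u , v) , λ ()

data FromCases (i j : ℕ) (x : Node) : Set where
  at-cell : x ≡ cell i j → FromCases i j x
  at-diag : x ≡ diag (suc i) (suc j) → FromCases i j x
  below   : From (suc i) j x → FromCases i j x
  beside  : From i (suc j) x → FromCases i j x

From-cases : ∀ {i j} x → From i j x → FromCases i j x
From-cases (cell i′ j′) (p , q) with m≤n⇒m<n∨m≡n p | m≤n⇒m<n∨m≡n q
... | inj₁ i<i′ | _ = below (i<i′ , q)
... | inj₂ refl | inj₁ j<j′ = beside (p , j<j′)
... | inj₂ refl | inj₂ refl = at-cell refl
From-cases (diag i′ j′) (p , q) with m≤n⇒m<n∨m≡n p | m≤n⇒m<n∨m≡n q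
... | inj₁ i<i′ | _ = below (i<i′ , q)
... | inj₂ refl | inj₁ j<j′ = beside (p , j<j′)
... | inj₂ refl | inj₂ refl = at-diag refl

row≤ : ∀ {i j I J x} → From i j x → UpTo I J x → i ≤ I
row≤ {x = cell _ _} (p , _) (u , _) = ≤-trans p u
row≤ {x = diag _ _} (p , _) (u , _) = ≤-trans (<⇒≤ p) u

col≤ : ∀ {i j I J x} → From i j x → UpTo I J x → j ≤ J
col≤ {x = cell _ _} (_ , q) (_ , v) = ≤-trans q v
col≤ {x = diag _ _} (_ , q) (_ , v) = ≤-trans (<⇒≤ q) v

module Chains (δ : ℕ → ℕ → ℕ) (c : ℕ) (δ≤c : ∀ i j → δ i j ≤ c) (I J : ℕ) where
  open DTW δ

  w : Node → ℕ
  w (cell i j) = c ∸ δ i j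
  w (diag i j) = c

  weight : List Node → ℕ
  weight ch = sum (map w ch)

  w-cell+δ≡c : ∀ i j → w (cell i j) + δ i j ≡ c
  w-cell+δ≡c i j = m∸n+n≡m (δ≤c i j)

  extra-column : ∀ a b → c + suc (a + b) * c ≡ suc (a + suc b) * c
  extra-column a b = cong (λ z → suc z * c) (sym (+-suc a b))

  dtw≤[1+a+b]*c : ∀ i j a b → dtw i j a b ≤ suc (a + b) * c
  dtw≤[1+a+b]*c i j zero    zero    = ≤-trans (δ≤c i j) (≤-reflexive (sym (+-identityʳ c)))
  dtw≤[1+a+b]*c i j (suc a) b       = ≤-trans (dtw-down i j a b) (+-mono-≤ (δ≤c i j) (dtw≤[1+a+b]*c (suc i) j a b))
  dtw≤[1+a+b]*c i j zero    (suc b) = ≤-trans (dtw-right i j zero b) (+-mono-≤ (δ≤c i j) (dtw≤[1+a+b]*c i (suc j) zero b))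

  -- h is 0, or the weight of cell i j when the chain passes through (i, j).
  absorb-δ : ∀ {h X E E′ K} i j → h + δ i j ≤ c → E ≤ δ i j + E′ → X + E′ ≤ K → (h + X) + E ≤ c + K
  absorb-δ {h} {X} {E} {E′} {K} i j hδ≤c E≤ X+E′≤K = begin
    (h + X) + E            ≤⟨ +-monoʳ-≤ (h + X) E≤ ⟩
    (h + X) + (δ i j + E′) ≡⟨ interchange h X (δ i j) E′ ⟩
    (h + δ i j) + (X + E′) ≤⟨ +-mono-≤ hδ≤c X+E′≤K ⟩
    c + K                  ∎
    where open ≤-Reasoning

  cell-bonus : ∀ i j → w (cell i j) + δ i j ≤ c
  cell-bonus i j = ≤-reflexive (w-cell+δ≡c i j)

  single-cell-bound : ∀ i j a b → weight (cell i j ∷ []) + dtw i j a b ≤ suc (a + b) * c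
  single-cell-bound i j zero zero = absorb-δ {E′ = 0} {K = 0} i j (cell-bonus i j) (≤-reflexive (sym (+-identityʳ _))) z≤n
  single-cell-bound i j (suc a) b = absorb-δ i j (cell-bonus i j) (dtw-down i j a b) (dtw≤[1+a+b]*c (suc i) j a b)
  single-cell-bound i j zero (suc b) = absorb-δ i j (cell-bonus i j) (dtw-right i j zero b) (dtw≤[1+a+b]*c i (suc j) zero b)

  chain-bound : ∀ i j a b → i + a ≡ I → j + b ≡ J → ∀ ch → Linked _≺_ ch → All (From i j) ch → All (UpTo I J) ch →
                weight ch + dtw i j a b ≤ suc (a + b) * c

  chain-bound-down : ∀ {h} i j a b → h + δ i j ≤ c → i + a ≡ I → j + b ≡ J → ∀ ch → Linked _≺_ ch →
            All (From (suc i) j) ch → All (UpTo I J) ch → suc i ≤ I → (h + weight ch) + dtw i j a b ≤ suc (a + b) * c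
  chain-bound-down i j a b hδ≤c ea eb ch lk fs us si with a′ , refl ← positive-offset (subst (suc i ≤_) (sym ea) si)
    = absorb-δ i j hδ≤c (dtw-down i j a′ b) (chain-bound (suc i) j a′ b (trans (sym (+-suc i a′)) ea) eb ch lk fs us)

  chain-bound-right : ∀ {h} i j a b → h + δ i j ≤ c → i + a ≡ I → j + b ≡ J → ∀ ch → Linked _≺_ ch →
             All (From i (suc j)) ch → All (UpTo I J) ch → suc j ≤ J → (h + weight ch) + dtw i j a b ≤ suc (a + b) * c
  chain-bound-right {h} i j a b hδ≤c ea eb ch lk fs us sj with b′ , refl ← positive-offset (subst (suc j ≤_) (sym eb) sj)
    = subst ((h + weight ch) + dtw i j a (suc b′) ≤_) (extra-column a b′)
        (absorb-δ i j hδ≤c (dtw-right i j a b′) (chain-bound i (suc j) a b′ ea (trans (sym (+-suc j b′)) eb) ch lk fs us))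

  chain-bound-diag : ∀ {h} i j a b → h + δ i j ≤ c → i + a ≡ I → j + b ≡ J → ∀ ch → Linked _≺_ (diag (suc i) (suc j) ∷ ch) →
            All (UpTo I J) (diag (suc i) (suc j) ∷ ch) → (h + weight (diag (suc i) (suc j) ∷ ch)) + dtw i j a b ≤ suc (a + b) * c
  chain-bound-diag {h} i j a b hδ≤c ea eb ch lk ((si , sj) ∷ us)
    with a′ , refl ← positive-offset (subst (suc i ≤_) (sym ea) si)
       | b′ , refl ← positive-offset (subst (suc j ≤_) (sym eb) sj)
    = subst ((h + (c + weight ch)) + dtw i j (suc a′) (suc b′) ≤_) (cong (c +_) (extra-column a′ b′))
        (absorb-δ i j hδ≤c (dtw-diag i j a′ b′) (begin
          (c + weight ch) + dtw (suc i) (suc j) a′ b′ ≡⟨ +-assoc c (weight ch) _ ⟩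
          c + (weight ch + dtw (suc i) (suc j) a′ b′) ≤⟨ +-monoʳ-≤ c (chain-bound (suc i) (suc j) a′ b′
                 (trans (sym (+-suc i a′)) ea) (trans (sym (+-suc j b′)) eb) ch (Linked.tail lk) (after-diag lk) us) ⟩
          c + suc (a′ + b′) * c ∎))
    where open ≤-Reasoning

  chain-bound i j a b ea eb [] _ _ _ = dtw≤[1+a+b]*c i j a b
  chain-bound i j a b ea eb (x ∷ ch) lk (fx ∷ _) us with From-cases x fx
  ... | below f = chain-bound-down i j a b (δ≤c i j) ea eb (x ∷ ch) lk (From-chain f lk) us (row≤ f (All.head us))
  ... | beside f = chain-bound-right i j a b (δ≤c i j) ea eb (x ∷ ch) lk (From-chain f lk) us (col≤ f (All.head us))
  ... | at-diag refl = chain-bound-diag i j a b (δ≤c i j) ea eb ch lk us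
  chain-bound i j a b ea eb (x ∷ []) lk _ _ | at-cell refl = single-cell-bound i j a b
  chain-bound i j a b ea eb (x ∷ y ∷ ch) (x≺y ∷ lk) _ (_ ∷ us) | at-cell refl
    with after-cell x≺y
  ... | fy , y≢x with From-cases y fy
  ...   | at-cell y≡x = ⊥-elim (y≢x y≡x)
  ...   | below f = chain-bound-down i j a b (cell-bonus i j) ea eb (y ∷ ch) lk (From-chain f lk) us (row≤ f (All.head us))
  ...   | beside f = chain-bound-right i j a b (cell-bonus i j) ea eb (y ∷ ch) lk (From-chain f lk) us (col≤ f (All.head us))
  ...   | at-diag refl = chain-bound-diag i j a b (cell-bonus i j) ea eb ch lk us

  OptimalChain : ℕ → ℕ → ℕ → ℕ → Set
  OptimalChain i j a b = ∃[ ch ] (Linked _≺_ (cell i j ∷ ch) × All (UpTo I J) (cell i j ∷ ch)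
                                 × weight (cell i j ∷ ch) + dtw i j a b ≡ suc (a + b) * c)

  cell-absorb : ∀ {W E′ K} i j → W + E′ ≡ K → (w (cell i j) + W) + (δ i j + E′) ≡ c + K
  cell-absorb {W} {E′} {K} i j eq = begin
    (w (cell i j) + W) + (δ i j + E′) ≡⟨ interchange (w (cell i j)) W (δ i j) E′ ⟩
    (w (cell i j) + δ i j) + (W + E′) ≡⟨ cong₂ _+_ (w-cell+δ≡c i j) eq ⟩
    c + K                             ∎
    where open ≡-Reasoning

  corner-UpTo : ∀ {i j a b} → i + a ≡ I → j + b ≡ J → UpTo I J (cell i j)
  corner-UpTo {i} {j} {a} {b} refl refl = m≤m+n i a , m≤m+n j b

  optimal-chain : ∀ i j a b → i + a ≡ I → j + b ≡ J → OptimalChain i j a b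

  optimal-down : ∀ i j a b → i + suc a ≡ I → j + b ≡ J → dtw i j (suc a) b ≡ δ i j + dtw (suc i) j a b →
                 OptimalChain i j (suc a) b
  optimal-down i j a b ea eb eq with optimal-chain (suc i) j a b (trans (sym (+-suc i a)) ea) eb
  ... | ch , lk , us , opt = cell (suc i) j ∷ ch , cell≺cell (n≤1+n i) ≤-refl (inj₁ ≤-refl) ∷ lk ,
        corner-UpTo ea eb ∷ us , trans (cong (weight (cell i j ∷ cell (suc i) j ∷ ch) +_) eq) (cell-absorb i j opt)

  optimal-right : ∀ i j a b → i + a ≡ I → j + suc b ≡ J → dtw i j a (suc b) ≡ δ i j + dtw i (suc j) a b →
                  OptimalChain i j a (suc b)
  optimal-right i j a b ea eb eq with optimal-chain i (suc j) a b ea (trans (sym (+-suc j b)) eb)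
  ... | ch , lk , us , opt = cell i (suc j) ∷ ch , cell≺cell ≤-refl (n≤1+n j) (inj₂ ≤-refl) ∷ lk ,
        corner-UpTo ea eb ∷ us ,
        trans (cong (weight (cell i j ∷ cell i (suc j) ∷ ch) +_) eq) (trans (cell-absorb i j opt) (extra-column a b))

  optimal-diag : ∀ i j a b → i + suc a ≡ I → j + suc b ≡ J → dtw i j (suc a) (suc b) ≡ δ i j + dtw (suc i) (suc j) a b →
                 OptimalChain i j (suc a) (suc b)
  optimal-diag i j a b ea eb eq with optimal-chain (suc i) (suc j) a b (trans (sym (+-suc i a)) ea) (trans (sym (+-suc j b)) eb)
  ... | ch , lk , us , opt = diag (suc i) (suc j) ∷ cell (suc i) (suc j) ∷ ch ,
        cell≺diag ≤-refl ≤-refl ∷ diag≺cell ≤-refl ≤-refl ∷ lk , corner-UpTo ea eb ∷ All.head us ∷ us ,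
        trans (cong (weight (cell i j ∷ diag (suc i) (suc j) ∷ cell (suc i) (suc j) ∷ ch) +_) eq)
          (trans (cell-absorb {W = c + weight (cell (suc i) (suc j) ∷ ch)} i j (trans (+-assoc c _ _) (cong (c +_) opt)))
                 (extra-column (suc a) b))

  optimal-chain i j zero zero ea eb =
    [] , [-] , corner-UpTo ea eb ∷ [] ,
    trans (cong (weight (cell i j ∷ []) +_) (sym (+-identityʳ (δ i j)))) (cell-absorb {W = 0} {E′ = 0} i j refl)
  optimal-chain i j (suc a) zero ea eb = optimal-down i j a zero ea eb refl
  optimal-chain i j zero (suc b) ea eb = optimal-right i j zero b ea eb refl
  optimal-chain i j (suc a) (suc b) ea eb
    with min3-sel (dtw (suc i) j a (suc b)) (dtw i (suc j) (suc a) b) (dtw (suc i) (suc j) a b)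
  ... | inj₁ m = optimal-down i j a (suc b) ea eb (cong (δ i j +_) m)
  ... | inj₂ (inj₁ m) = optimal-right i j (suc a) b ea eb (cong (δ i j +_) m)
  ... | inj₂ (inj₂ m) = optimal-diag i j a b ea eb (cong (δ i j +_) m)

module Lex (M : ℕ) where

  Digit : ℕ → Set
  Digit b = 1 ≤ b × b ≤ M

  lex-< : ∀ {a a′ b b′} → a < a′ → b ≤ M → 1 ≤ b′ → a * M + b < a′ * M + b′
  lex-< {a} {a′} {b} {b′} a<a′ b≤M 1≤b′ = begin-strict
    a * M + b  ≤⟨ +-monoʳ-≤ (a * M) b≤M ⟩
    a * M + M  ≡⟨ +-comm (a * M) M ⟩
    suc a * M  ≤⟨ *-monoˡ-≤ M a<a′ ⟩
    a′ * M     <⟨ m<m+n (a′ * M) 1≤b′ ⟩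
    a′ * M + b′ ∎
    where open ≤-Reasoning

  lex-<⁻ : ∀ {a a′ b b′} → Digit b → Digit b′ → a * M + b < a′ * M + b′ → a < a′ ⊎ (a ≡ a′ × b < b′)
  lex-<⁻ {a} {a′} {b} {b′} db db′ lt with <-cmp a a′
  ... | tri< a<a′ _ _ = inj₁ a<a′
  ... | tri≈ _ refl _ = inj₂ (refl , +-cancelˡ-< (a * M) b b′ lt)
  ... | tri> _ _ a′<a = ⊥-elim (<-asym lt (lex-< a′<a (proj₂ db′) (proj₁ db)))

  lex-<⁺ : ∀ {a a′ b b′} → Digit b → Digit b′ → a < a′ ⊎ (a ≡ a′ × b < b′) → a * M + b < a′ * M + b′
  lex-<⁺ db db′ (inj₁ a<a′) = lex-< a<a′ (proj₂ db) (proj₁ db′)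
  lex-<⁺ {a} db db′ (inj₂ (refl , b<b′)) = +-monoʳ-< (a * M) b<b′

  lex-injective : ∀ {a a′ b b′} → Digit b → Digit b′ → a * M + b ≡ a′ * M + b′ → a ≡ a′ × b ≡ b′
  lex-injective {a} {a′} {b} {b′} db db′ e with <-cmp a a′
  ... | tri< a<a′ _ _ = ⊥-elim (<-irrefl e (lex-< a<a′ (proj₂ db) (proj₁ db′)))
  ... | tri≈ _ refl _ = refl , +-cancelˡ-≡ (a * M) b b′ e
  ... | tri> _ _ a′<a = ⊥-elim (<-irrefl (sym e) (lex-< a′<a (proj₂ db′) (proj₁ db)))

-- The order of positions: row by row, the elements r̃(i, ·) (in decreasing
-- column) coming after all of row i - 1.
_⊏_ : Node → Node → Set
cell i j ⊏ cell i′ j′ = i < i′ ⊎ (i ≡ i′ × j < j′)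
cell i j ⊏ diag i′ j′ = i < i′
diag i j ⊏ cell i′ j′ = i ≤ i′
diag i j ⊏ diag i′ j′ = i < i′ ⊎ (i ≡ i′ × j′ < j)

≺⇒⊏ : ∀ {x y} → x ≺ y → x ⊏ y × transpose x ⊏ transpose y
≺⇒⊏ (cell≺cell u v (inj₁ i<i′)) with m≤n⇒m<n∨m≡n v
... | inj₁ j<j′ = inj₁ i<i′ , inj₁ j<j′
... | inj₂ refl = inj₁ i<i′ , inj₂ (refl , i<i′)
≺⇒⊏ (cell≺cell u v (inj₂ j<j′)) with m≤n⇒m<n∨m≡n u
... | inj₁ i<i′ = inj₁ i<i′ , inj₁ j<j′
... | inj₂ refl = inj₂ (refl , j<j′) , inj₁ j<j′
≺⇒⊏ (cell≺diag u v) = u , v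
≺⇒⊏ (diag≺cell u v) = u , v
≺⇒⊏ (diag≺diag u v) = inj₁ u , inj₁ v

⊏⇒≺ : ∀ {x y} → x ⊏ y → transpose x ⊏ transpose y → x ≺ y
⊏⇒≺ {cell _ _} {cell _ _} (inj₁ u) (inj₁ v) = cell≺cell (<⇒≤ u) (<⇒≤ v) (inj₁ u)
⊏⇒≺ {cell _ _} {cell _ _} (inj₁ u) (inj₂ (refl , _)) = cell≺cell (<⇒≤ u) ≤-refl (inj₁ u)
⊏⇒≺ {cell _ _} {cell _ _} (inj₂ (refl , _)) (inj₁ v) = cell≺cell ≤-refl (<⇒≤ v) (inj₂ v)
⊏⇒≺ {cell _ _} {cell _ _} (inj₂ (refl , _)) (inj₂ (refl , v)) = ⊥-elim (<-irrefl refl v)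
⊏⇒≺ {cell _ _} {diag _ _} u v = cell≺diag u v
⊏⇒≺ {diag _ _} {cell _ _} u v = diag≺cell u v
⊏⇒≺ {diag _ _} {diag _ _} (inj₁ u) (inj₁ v) = diag≺diag u v
⊏⇒≺ {diag _ _} {diag _ _} (inj₁ u) (inj₂ (refl , v)) = ⊥-elim (<-asym u v)
⊏⇒≺ {diag _ _} {diag _ _} (inj₂ (refl , u)) (inj₁ v) = ⊥-elim (<-asym u v)
⊏⇒≺ {diag _ _} {diag _ _} (inj₂ (refl , _)) (inj₂ (refl , v)) = ⊥-elim (<-irrefl refl v)

-- code k₀ lays out a grid with suc k₀ columns: it is f for k₀ = |B| - 1, and
-- the integer value q (after transposing) for k₀ = |A| - 1.
module Code (k₀ : ℕ) where

  K : ℕ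
  K = 2 * suc k₀ ∸ 1

  K≡ : K ≡ k₀ + suc k₀
  K≡ = cong (k₀ +_) (cong suc (+-identityʳ k₀))

  code : Node → ℕ
  code (cell i j) = (i ∸ 1) * K + j
  code (diag i j) = (i ∸ 1) * K + 2 ∸ j

  data Fits : Node → Set where
    cell : ∀ i₀ j₀ → j₀ ≤ k₀ → Fits (cell (suc i₀) (suc j₀))
    diag : ∀ i₀ j₀ → suc j₀ ≤ k₀ → Fits (diag (suc (suc i₀)) (suc (suc j₀)))

  block digit : Node → ℕ
  block (cell i j) = i ∸ 1
  block (diag i j) = i ∸ 2
  digit (cell i j) = j
  digit (diag i j) = K ∸ (j ∸ 2)

  width<K : suc k₀ ≤ K
  width<K = subst (suc k₀ ≤_) (sym K≡) (m≤n+m (suc k₀) k₀)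

  ≤K : ∀ {j₀} → suc j₀ ≤ k₀ → j₀ ≤ K
  ≤K h = ≤-trans (≤-trans (n≤1+n _) h) (≤-trans (n≤1+n k₀) width<K)

  diag-digit-large : ∀ {j₀} → suc j₀ ≤ k₀ → suc k₀ < K ∸ j₀
  diag-digit-large {j₀} h = begin-strict
    suc k₀              <⟨ m<n+m (suc k₀) (m<n⇒0<n∸m h) ⟩
    (k₀ ∸ j₀) + suc k₀  ≡⟨ sym (+-∸-comm (suc k₀) (≤-trans (n≤1+n _) h)) ⟩
    (k₀ + suc k₀) ∸ j₀  ≡⟨ cong (_∸ j₀) (sym K≡) ⟩
    K ∸ j₀              ∎
    where open ≤-Reasoning

  code≡digits : ∀ {x} → Fits x → code x ≡ block x * K + digit x
  code≡digits (cell i₀ j₀ _) = refl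
  code≡digits (diag i₀ j₀ h) = begin
    (suc i₀ * K + 2) ∸ (2 + j₀) ≡⟨ cong (_∸ (2 + j₀)) (+-comm (suc i₀ * K) 2) ⟩
    (2 + suc i₀ * K) ∸ (2 + j₀) ≡⟨ [m+n]∸[m+o]≡n∸o 2 (suc i₀ * K) j₀ ⟩
    (K + i₀ * K) ∸ j₀           ≡⟨ cong (_∸ j₀) (+-comm K (i₀ * K)) ⟩
    (i₀ * K + K) ∸ j₀           ≡⟨ +-∸-assoc (i₀ * K) (≤K h) ⟩
    i₀ * K + (K ∸ j₀)           ∎
    where open ≡-Reasoning

  open Lex K

  digit-bounds : ∀ {x} → Fits x → Digit (digit x)
  digit-bounds (cell i₀ j₀ h) = s≤s z≤n , ≤-trans (s≤s h) width<K
  digit-bounds (diag i₀ j₀ h) = ≤-trans (s≤s z≤n) (<⇒≤ (diag-digit-large h)) , m∸n≤m K j₀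

  code-positive : ∀ {x} → Fits x → 1 ≤ code x
  code-positive fx = subst (1 ≤_) (sym (code≡digits fx)) (≤-trans (proj₁ (digit-bounds fx)) (m≤n+m _ _))

  code-<⇒⊏ : ∀ {x y} → Fits x → Fits y → code x < code y → x ⊏ y
  code-<⇒⊏ {x} {y} fx fy lt
    with lex-<⁻ {block x} {block y} (digit-bounds fx) (digit-bounds fy) (subst₂ _<_ (code≡digits fx) (code≡digits fy) lt)
  code-<⇒⊏ (cell _ _ _) (cell _ _ _) _ | inj₁ p = inj₁ (s≤s p)
  code-<⇒⊏ (cell _ _ _) (cell _ _ _) _ | inj₂ (refl , q) = inj₂ (refl , q)
  code-<⇒⊏ (cell _ _ _) (diag _ _ _) _ | inj₁ p = s≤s (s≤s (<⇒≤ p))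
  code-<⇒⊏ (cell _ _ _) (diag _ _ _) _ | inj₂ (refl , _) = s≤s (s≤s ≤-refl)
  code-<⇒⊏ (diag _ _ _) (cell _ _ _) _ | inj₁ p = s≤s p
  code-<⇒⊏ (diag _ _ h) (cell _ _ h′) _ | inj₂ (refl , q) = ⊥-elim (<-asym (diag-digit-large h) (≤-trans q (s≤s h′)))
  code-<⇒⊏ (diag _ _ _) (diag _ _ _) _ | inj₁ p = inj₁ (s≤s (s≤s p))
  code-<⇒⊏ (diag _ j₀ h) (diag _ j₁ h′) _ | inj₂ (refl , q) with <-cmp j₁ j₀
  ... | tri< p _ _ = inj₂ (refl , s≤s (s≤s p))
  ... | tri≈ _ refl _ = ⊥-elim (<-irrefl refl q)
  ... | tri> _ _ p = ⊥-elim (<-asym q (∸-monoʳ-< p (≤K h′)))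

  ⊏⇒code-< : ∀ {x y} → Fits x → Fits y → x ⊏ y → code x < code y
  ⊏⇒code-< {x} {y} fx fy x⊏y =
    subst₂ _<_ (sym (code≡digits fx)) (sym (code≡digits fy)) (lex-<⁺ (digit-bounds fx) (digit-bounds fy) (digits fx fy x⊏y))
    where
    digits : ∀ {x y} → Fits x → Fits y → x ⊏ y → block x < block y ⊎ (block x ≡ block y × digit x < digit y)
    digits (cell _ _ _) (cell _ _ _) (inj₁ (s≤s p)) = inj₁ p
    digits (cell _ _ _) (cell _ _ _) (inj₂ (refl , q)) = inj₂ (refl , q)
    digits (cell _ _ h) (diag _ _ h′) (s≤s (s≤s p)) with m≤n⇒m<n∨m≡n p
    ... | inj₁ p′ = inj₁ p′
    ... | inj₂ refl = inj₂ (refl , ≤-trans (s≤s (s≤s h)) (diag-digit-large h′))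
    digits (diag _ _ _) (cell _ _ _) (s≤s p) = inj₁ p
    digits (diag _ _ _) (diag _ _ _) (inj₁ (s≤s (s≤s p))) = inj₁ p
    digits (diag _ _ h) (diag _ _ _) (inj₂ (refl , s≤s (s≤s q))) = inj₂ (refl , ∸-monoʳ-< q (≤K h))

  code-injective : ∀ {x y} → Fits x → Fits y → code x ≡ code y → x ≡ y
  code-injective {x} {y} fx fy e
    with lex-injective {block x} {block y} (digit-bounds fx) (digit-bounds fy) (trans (sym (code≡digits fx)) (trans e (code≡digits fy)))
  code-injective (cell _ _ _) (cell _ _ _) _ | refl , refl = refl
  code-injective (cell _ _ h) (diag _ _ h′) _ | refl , q = ⊥-elim (<-irrefl q (≤-trans (s≤s (s≤s h)) (diag-digit-large h′)))
  code-injective (diag _ _ h) (cell _ _ h′) _ | refl , q = ⊥-elim (<-irrefl (sym q) (≤-trans (s≤s (s≤s h′)) (diag-digit-large h)))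
  code-injective (diag _ _ h) (diag _ _ h′) _ | refl , q with ∸-cancelˡ-≡ (≤K h) (≤K h′) q
  ... | refl = refl

  RowFrom⇒code≥ : ∀ {A x} → Fits (cell A 1) → Fits x → RowFrom A x → code (cell A 1) ≤ code x
  RowFrom⇒code≥ fA@(cell _ zero _) fx@(cell _ _ _) (s≤s p) with m≤n⇒m<n∨m≡n p
  ... | inj₁ q = <⇒≤ (⊏⇒code-< fA fx (inj₁ (s≤s q)))
  RowFrom⇒code≥ (cell _ zero _) (cell _ zero _) _ | inj₂ refl = ≤-refl
  RowFrom⇒code≥ fA@(cell _ zero _) fx@(cell _ (suc _) _) _ | inj₂ refl = <⇒≤ (⊏⇒code-< fA fx (inj₂ (refl , s≤s (s≤s z≤n))))
  RowFrom⇒code≥ fA@(cell _ zero _) fx@(diag _ _ _) p = <⇒≤ (⊏⇒code-< fA fx p)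

  RowUpTo⇒code≤ : ∀ {B x} → Fits (cell B (suc k₀)) → Fits x → RowUpTo B x → code x ≤ code (cell B (suc k₀))
  RowUpTo⇒code≤ fB@(cell _ _ _) fx@(cell _ _ h) (s≤s p) with m≤n⇒m<n∨m≡n p | m≤n⇒m<n∨m≡n h
  ... | inj₁ q | _ = <⇒≤ (⊏⇒code-< fx fB (inj₁ (s≤s q)))
  ... | inj₂ refl | inj₁ q = <⇒≤ (⊏⇒code-< fx fB (inj₂ (refl , s≤s q)))
  ... | inj₂ refl | inj₂ refl = ≤-refl
  RowUpTo⇒code≤ fB@(cell _ _ _) fx@(diag _ _ _) p = <⇒≤ (⊏⇒code-< fx fB p)

  code≥⇒RowFrom : ∀ {A x} → Fits (cell A 1) → Fits x → code (cell A 1) ≤ code x → RowFrom A x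
  code≥⇒RowFrom fA fx le with m≤n⇒m<n∨m≡n le
  ... | inj₂ e with refl ← code-injective fA fx e = ≤-refl
  code≥⇒RowFrom {x = cell _ _} fA fx le | inj₁ lt with code-<⇒⊏ fA fx lt
  ... | inj₁ A<i = <⇒≤ A<i
  ... | inj₂ (refl , _) = ≤-refl
  code≥⇒RowFrom {x = diag _ _} fA fx le | inj₁ lt = code-<⇒⊏ fA fx lt

  code≤⇒RowUpTo : ∀ {B x} → Fits (cell B (suc k₀)) → Fits x → code x ≤ code (cell B (suc k₀)) → RowUpTo B x
  code≤⇒RowUpTo fB fx le with m≤n⇒m<n∨m≡n le
  ... | inj₂ e with refl ← code-injective fx fB e = ≤-refl
  code≤⇒RowUpTo {x = cell _ _} fB fx le | inj₁ lt with code-<⇒⊏ fx fB lt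
  ... | inj₁ i<B = <⇒≤ i<B
  ... | inj₂ (refl , _) = ≤-refl
  code≤⇒RowUpTo {x = diag _ _} fB fx le | inj₁ lt = code-<⇒⊏ fx fB lt

sel : Bool → ℕ → ℕ
sel b n = if b then n else 0

sel-mono : ∀ b b′ n → (T b → T b′) → sel b n ≤ sel b′ n
sel-mono true  true  n _ = ≤-refl
sel-mono true  false n f = ⊥-elim (f _)
sel-mono false _     n _ = z≤n

sel-<ᵇ-suc : ∀ k P n → sel (k <ᵇ suc P) n ≡ sel (k <ᵇ P) n + sel (k ≡ᵇ P) n
sel-<ᵇ-suc zero    zero    n = refl
sel-<ᵇ-suc zero    (suc P) n = sym (+-identityʳ n)
sel-<ᵇ-suc (suc k) zero    n = refl
sel-<ᵇ-suc (suc k) (suc P) n = sel-<ᵇ-suc k P n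

sel-≤ᵇ-suc : ∀ k P n → sel (k ≤ᵇ suc P) n ≡ sel (k ≤ᵇ P) n + sel (k ≡ᵇ suc P) n
sel-≤ᵇ-suc zero    P n = sym (+-identityʳ n)
sel-≤ᵇ-suc (suc k) P n = sel-<ᵇ-suc k P n

sum-zero : ∀ (g : ℕ → ℕ) xs → (∀ {x} → x ∈ xs → g x ≡ 0) → sum (map g xs) ≡ 0
sum-zero g [] _ = refl
sum-zero g (x ∷ xs) h = cong₂ _+_ (h (here refl)) (sum-zero g xs (h ∘ there))

sum-interval-one-hot : ∀ (g : ℕ → ℕ) a k {z} → z ∈ interval a k → (∀ {x} → x ∈ interval a k → x ≢ z → g x ≡ 0) →
                       sum (map g (interval a k)) ≡ g z
sum-interval-one-hot g a (suc k) (here refl) h =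
  trans (cong (g a +_) (sum-zero g _ (λ x∈ → h (there x∈) (λ { refl → n≮n a (proj₁ (∈-interval⁻ x∈)) }))))
        (+-identityʳ (g a))
sum-interval-one-hot g a (suc k) (there z∈) h =
  cong₂ _+_ (h (here refl) (λ { refl → n≮n a (proj₁ (∈-interval⁻ z∈)) })) (sum-interval-one-hot g (suc a) k z∈ (h ∘ there))

module _ (g : ℕ → ℕ → ℕ) (is js : List ℕ) where

  sum-grid-zero : (∀ {i j} → i ∈ is → j ∈ js → g i j ≡ 0) → sum (map (λ i → sum (map (g i) js)) is) ≡ 0
  sum-grid-zero h = sum-zero _ is (λ i∈ → sum-zero (g _) js (h i∈))

sum-grid-one-hot : ∀ (g : ℕ → ℕ → ℕ) a k a′ k′ {i₀ j₀} → i₀ ∈ interval a k → j₀ ∈ interval a′ k′ →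
                   (∀ {i j} → i ∈ interval a k → j ∈ interval a′ k′ → (i , j) ≢ (i₀ , j₀) → g i j ≡ 0) →
                   sum (map (λ i → sum (map (g i) (interval a′ k′))) (interval a k)) ≡ g i₀ j₀
sum-grid-one-hot g a k a′ k′ i₀∈ j₀∈ h =
  trans (sum-interval-one-hot _ a k i₀∈ (λ i∈ i≢ → sum-zero (g _) _ (λ j∈ → h i∈ j∈ (λ { refl → i≢ refl }))))
        (sum-interval-one-hot (g _) a′ k′ j₀∈ (λ j∈ j≢ → h i₀∈ j∈ (λ { refl → j≢ refl })))

module FilteredWeight {A : Set} (wt : A → ℕ) where

  filteredWeight : (A → Bool) → List A → ℕ
  filteredWeight p L = sum (map wt (filterᵇ p L))

  filteredWeight-∷ : ∀ p x xs → filteredWeight p (x ∷ xs) ≡ sel (p x) (wt x) + filteredWeight p xs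
  filteredWeight-∷ p x xs with p x
  ... | true  = refl
  ... | false = refl

  filteredWeight-++ : ∀ p xs ys → filteredWeight p (xs ++ ys) ≡ filteredWeight p xs + filteredWeight p ys
  filteredWeight-++ p [] ys = refl
  filteredWeight-++ p (x ∷ xs) ys = begin
    filteredWeight p (x ∷ xs ++ ys)                               ≡⟨ filteredWeight-∷ p x (xs ++ ys) ⟩
    sel (p x) (wt x) + filteredWeight p (xs ++ ys)                ≡⟨ cong (sel (p x) (wt x) +_) (filteredWeight-++ p xs ys) ⟩
    sel (p x) (wt x) + (filteredWeight p xs + filteredWeight p ys) ≡⟨ +-assoc (sel (p x) (wt x)) _ _ ⟨
    (sel (p x) (wt x) + filteredWeight p xs) + filteredWeight p ys ≡⟨ cong (_+ filteredWeight p ys) (filteredWeight-∷ p x xs) ⟨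
    filteredWeight p (x ∷ xs) + filteredWeight p ys                ∎
    where open ≡-Reasoning

  filteredWeight-concatMap : ∀ {B : Set} p (f : B → List A) L →
                             filteredWeight p (concatMap f L) ≡ sum (map (λ b → filteredWeight p (f b)) L)
  filteredWeight-concatMap p f [] = refl
  filteredWeight-concatMap p f (x ∷ L) =
    trans (filteredWeight-++ p (f x) (concatMap f L)) (cong (filteredWeight p (f x) +_) (filteredWeight-concatMap p f L))

  filteredWeight-map : ∀ {B : Set} p (f : B → A) L → filteredWeight p (map f L) ≡ sum (map (λ b → sel (p (f b)) (wt (f b))) L)
  filteredWeight-map p f [] = refl
  filteredWeight-map p f (x ∷ L) = trans (filteredWeight-∷ p (f x) (map f L)) (cong (sel (p (f x)) (wt (f x)) +_) (filteredWeight-map p f L))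

  filteredWeight-grid : ∀ p (f : ℕ → ℕ → A) is js →
                        filteredWeight p (concatMap (λ i → map (f i) js) is) ≡ sum (map (λ i → sum (map (λ j → sel (p (f i j)) (wt (f i j))) js)) is)
  filteredWeight-grid p f is js = trans (filteredWeight-concatMap p _ is) (cong sum (map-cong (λ i → filteredWeight-map p (f i) js) is))

  filteredWeight-mono : ∀ {p p′} → (∀ x → T (p x) → T (p′ x)) → ∀ L → filteredWeight p L ≤ filteredWeight p′ L
  filteredWeight-mono p⇒p′ [] = z≤n
  filteredWeight-mono {p} {p′} p⇒p′ (x ∷ L) rewrite filteredWeight-∷ p x L | filteredWeight-∷ p′ x L =
    +-mono-≤ (sel-mono (p x) (p′ x) (wt x) (p⇒p′ x)) (filteredWeight-mono p⇒p′ L)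

  wt≤filteredWeight : ∀ {p y} L → y ∈ L → T (p y) → wt y ≤ filteredWeight p L
  wt≤filteredWeight {p} (x ∷ L) (here refl) py rewrite filteredWeight-∷ p x L =
    ≤-trans (sel-mono true (p x) (wt x) (λ _ → py)) (m≤m+n _ _)
  wt≤filteredWeight {p} (x ∷ L) (there y∈L) py rewrite filteredWeight-∷ p x L =
    ≤-trans (wt≤filteredWeight L y∈L py) (m≤n+m _ _)

  filteredWeight-gap : ∀ {p p′ y} → (∀ x → T (p x) → T (p′ x)) → (T (p y) → ⊥) → T (p′ y) →
                       ∀ L → y ∈ L → filteredWeight p L + wt y ≤ filteredWeight p′ L
  filteredWeight-gap {p} {p′} p⇒p′ ¬py p′y (x ∷ L) (here refl) rewrite filteredWeight-∷ p x L | filteredWeight-∷ p′ x L =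
    gap (p x) (p′ x) ¬py p′y
    where
    gap : ∀ b b′ → (T b → ⊥) → T b′ → (sel b (wt x) + filteredWeight p L) + wt x ≤ sel b′ (wt x) + filteredWeight p′ L
    gap true  _    ¬b _ = ⊥-elim (¬b _)
    gap false true _  _ = ≤-trans (≤-reflexive (+-comm (filteredWeight p L) (wt x))) (+-monoʳ-≤ (wt x) (filteredWeight-mono p⇒p′ L))
  filteredWeight-gap {p} {p′} {y} p⇒p′ ¬py p′y (x ∷ L) (there y∈L) rewrite filteredWeight-∷ p x L | filteredWeight-∷ p′ x L =
    ≤-trans (≤-reflexive (+-assoc (sel (p x) (wt x)) _ (wt y)))
            (+-mono-≤ (sel-mono (p x) (p′ x) (wt x) (p⇒p′ x)) (filteredWeight-gap p⇒p′ ¬py p′y L y∈L))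

module PrefixWeight {A : Set} (key wt : A → ℕ) where
  open FilteredWeight wt public

  weight≤ weight≡ : ℕ → List A → ℕ
  weight≤ a = filteredWeight (λ q → key q ≤ᵇ a)
  weight≡ a = filteredWeight (λ q → key q ≡ᵇ a)

  weight≤-mono : ∀ {a b} L → a ≤ b → weight≤ a L ≤ weight≤ b L
  weight≤-mono L a≤b = filteredWeight-mono (λ x t → ≤⇒≤ᵇ (≤-trans (≤ᵇ⇒≤ (key x) _ t) a≤b)) L

  weight≤-gap : ∀ {y a b} L → y ∈ L → a < key y → key y ≤ b → weight≤ a L + wt y ≤ weight≤ b L
  weight≤-gap L y∈L a<y y≤b =
    filteredWeight-gap (λ x t → ≤⇒≤ᵇ (≤-trans (≤ᵇ⇒≤ (key x) _ t) (<⇒≤ (<-≤-trans a<y y≤b))))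
                       (λ t → <⇒≱ a<y (≤ᵇ⇒≤ _ _ t)) (≤⇒≤ᵇ y≤b) L y∈L

  wt≤weight≤ : ∀ {y b} L → y ∈ L → key y ≤ b → wt y ≤ weight≤ b L
  wt≤weight≤ L y∈L y≤b = wt≤filteredWeight L y∈L (≤⇒≤ᵇ y≤b)

  weight≤-zero : ∀ L → All (λ q → 1 ≤ key q) L → weight≤ 0 L ≡ 0
  weight≤-zero [] _ = refl
  weight≤-zero (x ∷ L) (1≤k ∷ hs) = trans (filteredWeight-∷ _ x L) (cong₂ _+_ (nothing-below 1≤k) (weight≤-zero L hs))
    where
    nothing-below : ∀ {k} → 1 ≤ k → sel (k ≤ᵇ 0) (wt x) ≡ 0
    nothing-below (s≤s _) = refl

  weight≤-suc : ∀ P L → weight≤ (suc P) L ≡ weight≤ P L + weight≡ (suc P) L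
  weight≤-suc P [] = refl
  weight≤-suc P (x ∷ L) = begin
    weight≤ (suc P) (x ∷ L)                                              ≡⟨ filteredWeight-∷ (λ q → key q ≤ᵇ suc P) x L ⟩
    sel (key x ≤ᵇ suc P) (wt x) + weight≤ (suc P) L                       ≡⟨ cong₂ _+_ (sel-≤ᵇ-suc (key x) P (wt x)) (weight≤-suc P L) ⟩
    (sel (key x ≤ᵇ P) (wt x) + sel (key x ≡ᵇ suc P) (wt x)) + (weight≤ P L + weight≡ (suc P) L)
                                                                          ≡⟨ interchange (sel (key x ≤ᵇ P) (wt x)) _ (weight≤ P L) _ ⟩
    (sel (key x ≤ᵇ P) (wt x) + weight≤ P L) + (sel (key x ≡ᵇ suc P) (wt x) + weight≡ (suc P) L)
                                                                          ≡⟨ cong₂ _+_ (filteredWeight-∷ (λ q → key q ≤ᵇ P) x L) (filteredWeight-∷ (λ q → key q ≡ᵇ suc P) x L) ⟨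
    weight≤ P (x ∷ L) + weight≡ (suc P) (x ∷ L)                           ∎
    where
    open ≡-Reasoning
  
  weight≤-split : ∀ P L → All (λ q → 1 ≤ key q) L → weight≤ P L ≡ sum (map (λ p → weight≡ p L) (interval 1 P))
  weight≤-split zero L hs = weight≤-zero L hs
  weight≤-split (suc P) L hs = begin
    weight≤ (suc P) L                                                  ≡⟨ weight≤-suc P L ⟩
    weight≤ P L + weight≡ (suc P) L                                    ≡⟨ cong₂ _+_ (weight≤-split P L hs) (sym (+-identityʳ _)) ⟩
    sum (map f (interval 1 P)) + sum (map f (interval (suc P) 1))     ≡⟨ sum-++ (map f (interval 1 P)) _ ⟨
    sum (map f (interval 1 P) ++ map f (interval (suc P) 1))          ≡⟨ cong sum (map-++ f (interval 1 P) _) ⟨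
    sum (map f (interval 1 P ++ interval (1 + P) 1))                  ≡⟨ cong (sum ∘ map f) (interval-++ 1 P 1) ⟨
    sum (map f (interval 1 (P + 1)))                                  ≡⟨ cong (λ k → sum (map f (interval 1 k))) (+-comm P 1) ⟩
    sum (map f (interval 1 (suc P)))                                  ∎
    where
    open ≡-Reasoning
    f : ℕ → ℕ
    f p = weight≡ p L

⊆-++-split : ∀ {A : Set} {xs : List A} as bs → xs ⊆ as ++ bs → ∃[ xs₁ ] ∃[ xs₂ ] (xs ≡ xs₁ ++ xs₂ × xs₁ ⊆ as × xs₂ ⊆ bs)
⊆-++-split [] bs p = [] , _ , refl , [] , p
⊆-++-split (a ∷ as) bs (.a ∷ʳ p) with xs₁ , xs₂ , refl , p₁ , p₂ ← ⊆-++-split as bs p = xs₁ , xs₂ , refl , a ∷ʳ p₁ , p₂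
⊆-++-split (a ∷ as) bs (refl ∷ p) with xs₁ , xs₂ , refl , p₁ , p₂ ← ⊆-++-split as bs p = a ∷ xs₁ , xs₂ , refl , refl ∷ p₁ , p₂

module Blocks {A : Set} (F : ℕ → List A) where

  data Blockwise (hi : ℕ) : ℕ → List A → Set where
    [] : ∀ {p} → Blockwise hi p []
    cons : ∀ {p p′ y ys} → p ≤ p′ → p′ < hi → y ∈ F p′ → Blockwise hi p′ ys → Blockwise hi p (y ∷ ys)

  Blockwise-weaken : ∀ {hi p p′ ys} → p′ ≤ p → Blockwise hi p ys → Blockwise hi p′ ys
  Blockwise-weaken _ [] = []
  Blockwise-weaken p′≤p (cons p≤ lt y∈ bw) = cons (≤-trans p′≤p p≤) lt y∈ bw

  ⊆⇒Blockwise : ∀ a l (xs : List A) → xs ⊆ concatMap F (interval a l) → Blockwise (a + l) a xs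
  ⊆⇒Blockwise a zero xs [] = []
  ⊆⇒Blockwise a (suc l) xs sub with xs₁ , xs₂ , refl , sub₁ , sub₂ ← ⊆-++-split (F a) _ sub = prepend xs₁ sub₁
    where
    a<a+l : a < a + suc l
    a<a+l = subst (a <_) (sym (+-suc a l)) (s≤s (m≤m+n a l))
    rest : Blockwise (a + suc l) (suc a) xs₂
    rest = subst (λ hi → Blockwise hi (suc a) xs₂) (sym (+-suc a l)) (⊆⇒Blockwise (suc a) l xs₂ sub₂)
    prepend : ∀ ys → ys ⊆ F a → Blockwise (a + suc l) a (ys ++ xs₂)
    prepend [] _ = Blockwise-weaken (n≤1+n a) rest
    prepend (y ∷ ys) sub = cons ≤-refl a<a+l (Any-resp-⊆ sub (here refl)) (prepend ys (∷ˡ⁻ sub))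

  module _ {E : Set} (G : E → List A) (key : E → ℕ) where

    KeyChain : List E → Set
    KeyChain = Linked (λ x y → key x < key y)

    InBlocks : ℕ → ℕ → E → Set
    InBlocks a l x = a ≤ key x × key x < a + l

    InBlocks-suc : ∀ {a l ch} → All (λ y → a < key y) ch → All (InBlocks a (suc l)) ch → All (InBlocks (suc a) l) ch
    InBlocks-suc [] [] = []
    InBlocks-suc {a} {l} {y ∷ _} (a<y ∷ a<ys) ((_ , y<) ∷ bs) = (a<y , subst (key y <_) (+-suc a l) y<) ∷ InBlocks-suc a<ys bs

    concatMap-⊆-blocks : ∀ a l ch → KeyChain ch → All (InBlocks a l) ch → All (λ x → G x ⊆ F (key x)) ch →
                         concatMap G ch ⊆ concatMap F (interval a l)
    concatMap-⊆-blocks a zero [] _ _ _ = []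
    concatMap-⊆-blocks a zero (x ∷ _) _ ((a≤x , x<a+0) ∷ _) _ =
      ⊥-elim (<⇒≱ x<a+0 (subst (_≤ key x) (sym (+-identityʳ a)) a≤x))
    concatMap-⊆-blocks a (suc l) [] _ _ _ = []⊆-universal _
    concatMap-⊆-blocks a (suc l) (x ∷ ch) lk bs@((a≤x , _) ∷ _) subs with m≤n⇒m<n∨m≡n a≤x
    ... | inj₂ refl = ++⁺ (All.head subs)
                        (concatMap-⊆-blocks (suc a) l ch (Linked.tail lk) (InBlocks-suc (Linked-on⇒All key lk) (All.tail bs)) (All.tail subs))
    ... | inj₁ a<x = ++⁺ ([]⊆-universal (F a))
                       (concatMap-⊆-blocks (suc a) l (x ∷ ch) lk (InBlocks-suc (a<x ∷ All.map (<-trans a<x) (Linked-on⇒All key lk)) bs) subs)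

module SequenceR {n₀ m₀ : ℕ} (d : Fin (suc n₀) → Fin (suc m₀) → ℕ) where
  open Aux d
  module Pos = Code m₀
  module Val = Code n₀

  element : Node → Entry
  element (cell i j) = r i j
  element (diag i j) = r~ i j

  data InGrid : Node → Set where
    cell : ∀ i₀ j₀ → i₀ ≤ n₀ → j₀ ≤ m₀ → InGrid (cell (suc i₀) (suc j₀))
    diag : ∀ i₀ j₀ → suc i₀ ≤ n₀ → suc j₀ ≤ m₀ → InGrid (diag (suc (suc i₀)) (suc (suc j₀)))

  fits-pos : ∀ {x} → InGrid x → Pos.Fits x
  fits-pos (cell i₀ j₀ _ h) = Pos.cell i₀ j₀ h
  fits-pos (diag i₀ j₀ _ h) = Pos.diag i₀ j₀ h

  fits-val : ∀ {x} → InGrid x → Val.Fits (transpose x)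
  fits-val (cell i₀ j₀ h _) = Val.cell j₀ i₀ h
  fits-val (diag i₀ j₀ h _) = Val.diag j₀ i₀ h

  pos≡code : ∀ x → pos (element x) ≡ Pos.code x
  pos≡code (cell i j) = refl
  pos≡code (diag i j) = refl

  val≡code : ∀ x → val (element x) ≡ Val.code (transpose x)
  val≡code (cell i j) = refl
  val≡code (diag i j) = refl

  transpose-injective : ∀ {x y} → transpose x ≡ transpose y → x ≡ y
  transpose-injective {cell _ _} {cell _ _} refl = refl
  transpose-injective {diag _ _} {diag _ _} refl = refl

  element-pos-injective : ∀ {x y} → InGrid x → InGrid y → pos (element x) ≡ pos (element y) → x ≡ y
  element-pos-injective {x} {y} gx gy e = Pos.code-injective (fits-pos gx) (fits-pos gy) (subst₂ _≡_ (pos≡code x) (pos≡code y) e)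

  element-val-injective : ∀ {x y} → InGrid x → InGrid y → val (element x) ≡ val (element y) → x ≡ y
  element-val-injective {x} {y} gx gy e =
    transpose-injective (Val.code-injective (fits-val gx) (fits-val gy) (subst₂ _≡_ (val≡code x) (val≡code y) e))

  ≺⇒pos< : ∀ {x y} → InGrid x → InGrid y → x ≺ y → pos (element x) < pos (element y)
  ≺⇒pos< {x} {y} gx gy x≺y =
    subst₂ _<_ (sym (pos≡code x)) (sym (pos≡code y)) (Pos.⊏⇒code-< (fits-pos gx) (fits-pos gy) (proj₁ (≺⇒⊏ x≺y)))

  ≺⇒val< : ∀ {x y} → InGrid x → InGrid y → x ≺ y → val (element x) < val (element y)
  ≺⇒val< {x} {y} gx gy x≺y =
    subst₂ _<_ (sym (val≡code x)) (sym (val≡code y)) (Val.⊏⇒code-< (fits-val gx) (fits-val gy) (proj₂ (≺⇒⊏ x≺y)))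

  <²⇒≺ : ∀ {x y} → InGrid x → InGrid y → pos (element x) < pos (element y) → val (element x) < val (element y) → x ≺ y
  <²⇒≺ {x} {y} gx gy p< v< =
    ⊏⇒≺ (Pos.code-<⇒⊏ (fits-pos gx) (fits-pos gy) (subst₂ _<_ (pos≡code x) (pos≡code y) p<))
        (Val.code-<⇒⊏ (fits-val gx) (fits-val gy) (subst₂ _<_ (val≡code x) (val≡code y) v<))

  cells diags : List Entry
  cells = concatMap (λ i → map (r i) (range 1 (suc m₀))) (range 1 (suc n₀))
  diags = concatMap (λ i → map (r~ i) (range 2 (suc m₀))) (range 2 (suc n₀))

  cells≡ : cells ≡ concatMap (λ i → map (r i) (interval 1 (suc m₀))) (interval 1 (suc n₀))
  cells≡ = cong₂ (λ is js → concatMap (λ i → map (r i) js) is) (range≡interval 1 (suc n₀)) (range≡interval 1 (suc m₀))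

  diags≡ : diags ≡ concatMap (λ i → map (r~ i) (interval 2 m₀)) (interval 2 n₀)
  diags≡ = cong₂ (λ is js → concatMap (λ i → map (r~ i) js) is) (range≡interval 2 (suc n₀)) (range≡interval 2 (suc m₀))

  cell-InGrid : ∀ {i j} → i ∈ interval 1 (suc n₀) → j ∈ interval 1 (suc m₀) → InGrid (cell i j)
  cell-InGrid i∈ j∈ with ∈-interval⁻ i∈ | ∈-interval⁻ j∈
  ... | s≤s z≤n , s≤s (s≤s i≤) | s≤s z≤n , s≤s (s≤s j≤) = cell _ _ i≤ j≤

  diag-InGrid : ∀ {i j} → i ∈ interval 2 n₀ → j ∈ interval 2 m₀ → InGrid (diag i j)
  diag-InGrid i∈ j∈ with ∈-interval⁻ i∈ | ∈-interval⁻ j∈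
  ... | s≤s (s≤s z≤n) , s≤s (s≤s i≤) | s≤s (s≤s z≤n) , s≤s (s≤s j≤) = diag _ _ i≤ j≤

  element∈entries : ∀ {x} → InGrid x → element x ∈ entries
  element∈entries (cell i₀ j₀ i≤ j≤) = ∈-++⁺ˡ (subst (r (suc i₀) (suc j₀) ∈_) (sym cells≡)
    (∈-grid⁺ r (interval 1 (suc n₀)) (interval 1 (suc m₀))
      (∈-interval⁺ (s≤s z≤n) (s≤s (s≤s i≤))) (∈-interval⁺ (s≤s z≤n) (s≤s (s≤s j≤)))))
  element∈entries (diag i₀ j₀ i≤ j≤) = ∈-++⁺ʳ cells (subst (r~ (suc (suc i₀)) (suc (suc j₀)) ∈_) (sym diags≡)
    (∈-grid⁺ r~ (interval 2 n₀) (interval 2 m₀)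
      (∈-interval⁺ (s≤s (s≤s z≤n)) (s≤s (s≤s i≤))) (∈-interval⁺ (s≤s (s≤s z≤n)) (s≤s (s≤s j≤)))))

  ∈entries⇒ : ∀ {e} → e ∈ entries → ∃[ x ] (InGrid x × e ≡ element x)
  ∈entries⇒ {e} e∈ with ∈-++⁻ cells e∈
  ... | inj₁ e∈cells
    with i , j , i∈ , j∈ , refl ← ∈-grid⁻ r (interval 1 (suc n₀)) (interval 1 (suc m₀)) (subst (e ∈_) cells≡ e∈cells)
    = cell i j , cell-InGrid i∈ j∈ , refl
  ... | inj₂ e∈diags
    with i , j , i∈ , j∈ , refl ← ∈-grid⁻ r~ (interval 2 n₀) (interval 2 m₀) (subst (e ∈_) diags≡ e∈diags)
    = diag i j , diag-InGrid i∈ j∈ , refl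

  module ByPos = PrefixWeight pos wt
  module ByVal = PrefixWeight val wt

  T⇒≡true : ∀ {b} → T b → b ≡ true
  T⇒≡true {true} _ = refl

  sel-pos-distinct : ∀ {x y} n → InGrid x → InGrid y → x ≢ y → sel (pos (element x) ≡ᵇ pos (element y)) n ≡ 0
  sel-pos-distinct {x} {y} n gx gy x≢y with pos (element x) ≡ᵇ pos (element y) in e
  ... | true = ⊥-elim (x≢y (element-pos-injective gx gy (≡ᵇ⇒≡ _ _ (subst T (sym e) _))))
  ... | false = refl

  weight-at-cell : ∀ {i j} → InGrid (cell i j) → ByPos.weight≡ (pos (r i j)) entries ≡ wt (r i j)
  weight-at-cell {i} {j} g@(cell i₀ j₀ i≤ j≤) = begin
    filteredWeight P (cells ++ diags)               ≡⟨ filteredWeight-++ P cells diags ⟩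
    filteredWeight P cells + filteredWeight P diags ≡⟨ cong₂ _+_ on-cells on-diags ⟩
    wt (r i j) + 0                                  ≡⟨ +-identityʳ _ ⟩
    wt (r i j)                                      ∎
    where
    open ≡-Reasoning
    open ByPos using (filteredWeight; filteredWeight-++; filteredWeight-grid)
    P : Entry → Bool
    P q = pos q ≡ᵇ pos (r i j)
    on-cells : filteredWeight P cells ≡ wt (r i j)
    on-cells = trans (cong (filteredWeight P) cells≡) (trans (filteredWeight-grid P r (interval 1 (suc n₀)) (interval 1 (suc m₀)))
      (trans (sum-grid-one-hot (λ i′ j′ → sel (P (r i′ j′)) (wt (r i′ j′))) 1 (suc n₀) 1 (suc m₀)
               (∈-interval⁺ (s≤s z≤n) (s≤s (s≤s i≤))) (∈-interval⁺ (s≤s z≤n) (s≤s (s≤s j≤)))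
               (λ i′∈ j′∈ ≢ → sel-pos-distinct _ (cell-InGrid i′∈ j′∈) g (λ { refl → ≢ refl })))
             (cong (λ b → sel b (wt (r i j))) (T⇒≡true (≡⇒≡ᵇ (pos (r i j)) _ refl)))))
    on-diags : filteredWeight P diags ≡ 0
    on-diags = trans (cong (filteredWeight P) diags≡) (trans (filteredWeight-grid P r~ (interval 2 n₀) (interval 2 m₀))
      (sum-grid-zero (λ i′ j′ → sel (P (r~ i′ j′)) (wt (r~ i′ j′))) (interval 2 n₀) (interval 2 m₀)
        (λ i′∈ j′∈ → sel-pos-distinct _ (diag-InGrid i′∈ j′∈) g λ ())))

  pos-positive : All (λ q → 1 ≤ pos q) entries
  pos-positive = All.tabulate λ e∈ → let x , gx , e≡ = ∈entries⇒ e∈ in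
    subst (λ q → 1 ≤ pos q) (sym e≡) (subst (1 ≤_) (sym (pos≡code x)) (Pos.code-positive (fits-pos gx)))

  h⊣-mono : ∀ q q′ → val q ≤ val q′ → h⊣ q ≤ h⊣ q′
  h⊣-mono q q′ = ByVal.weight≤-mono entries

  wt≤h⊣ : ∀ {x} → InGrid x → wt (element x) ≤ h⊣ (element x)
  wt≤h⊣ gx = ByVal.wt≤weight≤ entries (element∈entries gx) ≤-refl

  val<⇒h⊣<h⊢ : ∀ {x y} → InGrid y → val (element x) < val (element y) → h⊣ (element x) < h⊢ (element y)
  val<⇒h⊣<h⊢ gy lt = +≤⇒<∸+1 (ByVal.weight≤-gap entries (element∈entries gy) lt ≤-refl)

  val≤⇒h⊢≤ : ∀ {x y} → InGrid x → InGrid y → val (element x) ≤ val (element y) → h⊢ (element x) ≤ h⊢ (element y)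
  val≤⇒h⊢≤ {x} {y} gx gy le with m≤n⇒m<n∨m≡n le
  ... | inj₂ e with refl ← element-val-injective gx gy e = ≤-refl
  ... | inj₁ lt = begin
    h⊢ (element x)       ≤⟨ +-monoˡ-≤ 1 (m∸n≤m (h⊣ (element x)) (wt (element x))) ⟩
    h⊣ (element x) + 1   ≡⟨ +-comm (h⊣ (element x)) 1 ⟩
    suc (h⊣ (element x)) ≤⟨ val<⇒h⊣<h⊢ {x} gy lt ⟩
    h⊢ (element y)       ∎
    where open ≤-Reasoning

  ∈Sq⁻ : ∀ {y q} → y ∈ Sq q → ∃[ k ] (k < wt q × y ≡ h⊢ q + k)
  ∈Sq⁻ {q = q} y∈ with k , k∈ , refl ← ∈-map⁻ (h⊢ q +_) y∈ = k , ∈-upTo⁻ k∈ , refl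

  Sq-lower : ∀ {y q} → y ∈ Sq q → h⊢ q ≤ y
  Sq-lower {q = q} y∈ with k , _ , y≡ ← ∈Sq⁻ {q = q} y∈ = subst (h⊢ q ≤_) (sym y≡) (m≤m+n _ k)

  Sq-upper : ∀ {y x} → InGrid x → y ∈ Sq (element x) → y ≤ h⊣ (element x)
  Sq-upper {x = x} gx y∈ with k , k< , y≡ ← ∈Sq⁻ {q = element x} y∈ = subst (_≤ h⊣ (element x)) (sym y≡) (∸+1+<≤ (wt≤h⊣ gx) k<)

  length-Sq : ∀ q → length (Sq q) ≡ wt q
  length-Sq q = trans (length-map (h⊢ q +_) (upTo (wt q))) (length-upTo (wt q))

  Sq-increasing : ∀ q → Linked _<_ (Sq q)
  Sq-increasing q = map⁺ (Linked.map (+-monoʳ-< (h⊢ q)) (applyUpTo⁺₂ (λ i → i) (wt q) n<1+n))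

  block : ℕ → List ℕ
  block p = concatMap Sq (atPos p)

  length-blocks : ∀ ps → length (concatMap block ps) ≡ sum (map (λ p → ByPos.weight≡ p entries) ps)
  length-blocks ps = trans (length-concatMap block ps) (cong sum (map-cong length-block ps))
    where
    length-block : ∀ p → length (block p) ≡ ByPos.weight≡ p entries
    length-block p = trans (length-concatMap Sq (atPos p)) (cong sum (map-cong length-Sq (atPos p)))

  weight≤-as-length : ∀ P → ByPos.weight≤ P entries ≡ length (concatMap block (interval 1 P))
  weight≤-as-length P = trans (ByPos.weight≤-split P entries pos-positive) (sym (length-blocks (interval 1 P)))

  lenR-bound : ∀ {i₁} → i₁ ≤ n₀ → pos (r (suc i₁) (suc m₀)) ≤ lenR
  lenR-bound {i₁} i₁≤n₀ = begin
    i₁ * Pos.K + suc m₀           ≤⟨ +-monoˡ-≤ (suc m₀) (*-monoˡ-≤ Pos.K i₁≤n₀) ⟩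
    n₀ * Pos.K + suc m₀           ≡⟨ cong (λ K → n₀ * K + suc m₀) Pos.K≡ ⟩
    n₀ * (m₀ + suc m₀) + suc m₀   ≡⟨ grid-size n₀ m₀ ⟩
    suc n₀ * suc m₀ + n₀ * m₀     ∎
    where
    open ≤-Reasoning
    open import Data.Nat.Solver using (module +-*-Solver)
    open +-*-Solver
    grid-size : ∀ a b → a * (b + suc b) + suc b ≡ suc a * suc b + a * b
    grid-size = solve 2 (λ a b → a :* (b :+ (con 1 :+ b)) :+ (con 1 :+ b) := (con 1 :+ a) :* (con 1 :+ b) :+ a :* b) refl

  module Rows {i₀ i₁ : ℕ} (i₀≤i₁ : i₀ ≤ i₁) (i₁≤n₀ : i₁ ≤ n₀) where

    k p₁ l z : ℕ
    k = i₀ * Pos.K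
    p₁ = pos (r (suc i₁) (suc m₀))
    l = p₁ ∸ k
    z = lenR ∸ p₁

    k+l≡p₁ : k + l ≡ p₁
    k+l≡p₁ = m+[n∸m]≡n (≤-trans (*-monoˡ-≤ Pos.K i₀≤i₁) (m≤m+n _ _))

    before within after : List ℕ
    before = concatMap block (interval 1 k)
    within = concatMap block (interval (suc k) l)
    after = concatMap block (interval (suc p₁) z)

    S≡ : S ≡ before ++ within ++ after
    S≡ = begin
      concatMap block (range 1 lenR)                                           ≡⟨ cong (concatMap block) (range≡interval 1 lenR) ⟩
      concatMap block (interval 1 lenR)                                        ≡⟨ cong (λ n → concatMap block (interval 1 n)) lenR≡ ⟩
      concatMap block (interval 1 (k + (l + z)))                               ≡⟨ cong (concatMap block) (interval-++ 1 k (l + z)) ⟩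
      concatMap block (interval 1 k ++ interval (suc k) (l + z))               ≡⟨ concatMap-++ block (interval 1 k) _ ⟩
      before ++ concatMap block (interval (suc k) (l + z))                     ≡⟨ cong (λ ps → before ++ concatMap block ps) (interval-++ (suc k) l z) ⟩
      before ++ concatMap block (interval (suc k) l ++ interval (suc k + l) z) ≡⟨ cong (before ++_) (concatMap-++ block (interval (suc k) l) _) ⟩
      before ++ within ++ concatMap block (interval (suc (k + l)) z)           ≡⟨ cong (λ p → before ++ within ++ concatMap block (interval (suc p) z)) k+l≡p₁ ⟩
      before ++ within ++ after                                                ∎
      where
      open ≡-Reasoning
      lenR≡ : lenR ≡ k + (l + z)
      lenR≡ = trans (sym (m+[n∸m]≡n (lenR-bound i₁≤n₀))) (trans (cong (_+ z) (sym k+l≡p₁)) (+-assoc k l z))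

    G⊢≡ : G⊢ (suc i₀) ≡ length before + 1
    G⊢≡ = begin
      g⊣ q₀ ∸ wt q₀ + 1                   ≡⟨ cong (λ g → g ∸ wt q₀ + 1) g⊣q₀ ⟩
      (length before + wt q₀) ∸ wt q₀ + 1 ≡⟨ cong (_+ 1) (m+n∸n≡m (length before) (wt q₀)) ⟩
      length before + 1                   ∎
      where
      open ≡-Reasoning
      open ByPos using (weight≤; weight≡; weight≤-suc)
      q₀ : Entry
      q₀ = r (suc i₀) 1
      pos-q₀ : pos q₀ ≡ suc k
      pos-q₀ = +-comm k 1
      g⊣q₀ : g⊣ q₀ ≡ length before + wt q₀
      g⊣q₀ = begin
        weight≤ (pos q₀) entries                ≡⟨ cong (λ p → weight≤ p entries) pos-q₀ ⟩
        weight≤ (suc k) entries                 ≡⟨ weight≤-suc k entries ⟩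
        weight≤ k entries + weight≡ (suc k) entries
          ≡⟨ cong₂ _+_ (weight≤-as-length k) (trans (cong (λ p → weight≡ p entries) (sym pos-q₀))
                                                     (weight-at-cell (cell i₀ 0 (≤-trans i₀≤i₁ i₁≤n₀) z≤n))) ⟩
        length before + wt q₀                   ∎

    G⊣≡ : G⊣ (suc i₁) ≡ length before + length within
    G⊣≡ = begin
      ByPos.weight≤ p₁ entries                                ≡⟨ weight≤-as-length p₁ ⟩
      length (concatMap block (interval 1 p₁))                ≡⟨ cong (λ p → length (concatMap block (interval 1 p))) (sym k+l≡p₁) ⟩
      length (concatMap block (interval 1 (k + l)))           ≡⟨ cong (λ ps → length (concatMap block ps)) (interval-++ 1 k l) ⟩
      length (concatMap block (interval 1 k ++ interval (suc k) l)) ≡⟨ cong length (concatMap-++ block (interval 1 k) _) ⟩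
      length (before ++ within)                               ≡⟨ length-++ before ⟩
      length before + length within                           ∎
      where open ≡-Reasoning

    slice-rows : slice S (G⊢ (suc i₀)) (G⊣ (suc i₁)) ≡ within
    slice-rows = begin
      slice S (G⊢ (suc i₀)) (G⊣ (suc i₁))                                      ≡⟨ cong₂ (slice S) G⊢≡ G⊣≡ ⟩
      slice S (length before + 1) (length before + length within)              ≡⟨ cong (λ T → slice T (length before + 1) (length before + length within)) S≡ ⟩
      slice (before ++ within ++ after) (length before + 1) (length before + length within) ≡⟨ slice-middle before within after ⟩
      within                                                                   ∎
      where open ≡-Reasoning

  δ≤c : ∀ i j → dis d i j ≤ cmax d
  δ≤c i j with (i ∸ 1) <? suc n₀ | (j ∸ 1) <? suc m₀
  ... | no _ | _ = z≤n
  ... | yes _ | no _ = z≤n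
  ... | yes p | yes q = subst (_≤ cmax d) (dis-suc p q)
    (∈⇒≤-foldr-⊔ _ (∈-grid⁺ (dis d) (range 1 (suc n₀)) (range 1 (suc m₀)) (∈range₁ p) (∈range₁ q)))
    where
    ∈range₁ : ∀ {k K} → k < suc K → suc k ∈ range 1 (suc K)
    ∈range₁ {k} {K} k< = subst (suc k ∈_) (sym (range≡interval 1 (suc K))) (∈-interval⁺ (s≤s z≤n) (s≤s k<))
    dis-suc : ∀ {k l} (p : k < suc n₀) (q : l < suc m₀) → dis d (suc k) (suc l) ≡ d (fromℕ< p) (fromℕ< q)
    dis-suc {k} {l} p q with k <? suc n₀ | l <? suc m₀
    ... | yes _ | yes _ = refl
    ... | no ¬p | _ = ⊥-elim (¬p p)
    ... | yes _ | no ¬q = ⊥-elim (¬q q)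

module Window {n₀ m₀ : ℕ} (d : Fin (suc n₀) → Fin (suc m₀) → ℕ) (i₀ a j₀ b : ℕ) (ha : i₀ + a ≤ n₀) (hb : j₀ + b ≤ m₀) where
  open Aux d
  open SequenceR d
  open Rows (m≤m+n i₀ a) ha
  open Blocks block
  open DTW (dis d)

  I₀ I₁ J₀ J₁ : ℕ
  I₀ = suc i₀
  I₁ = suc (i₀ + a)
  J₀ = suc j₀
  J₁ = suc (j₀ + b)

  open Chains (dis d) (cmax d) δ≤c I₁ J₁

  InWindow : Node → Set
  InWindow x = From I₀ J₀ x × UpTo I₁ J₁ x

  InWindow⇒InGrid : ∀ {x} → InWindow x → InGrid x
  InWindow⇒InGrid {cell zero _} ((() , _) , _)
  InWindow⇒InGrid {cell (suc _) zero} ((_ , ()) , _)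
  InWindow⇒InGrid {cell (suc i) (suc j)} (_ , (s≤s i≤ , s≤s j≤)) = cell i j (≤-trans i≤ ha) (≤-trans j≤ hb)
  InWindow⇒InGrid {diag zero _} ((() , _) , _)
  InWindow⇒InGrid {diag (suc zero) _} ((s≤s () , _) , _)
  InWindow⇒InGrid {diag (suc (suc _)) zero} ((_ , ()) , _)
  InWindow⇒InGrid {diag (suc (suc _)) (suc zero)} ((_ , s≤s ()) , _)
  InWindow⇒InGrid {diag (suc (suc i)) (suc (suc j))} (_ , (s≤s i≤ , s≤s j≤)) = diag i j (≤-trans i≤ ha) (≤-trans j≤ hb)

  first-of-rows : Pos.Fits (cell I₀ 1)
  first-of-rows = Pos.cell i₀ 0 (z≤n)

  last-of-rows : Pos.Fits (cell I₁ (suc m₀))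
  last-of-rows = Pos.cell (i₀ + a) m₀ ≤-refl

  first-of-cols : Val.Fits (cell J₀ 1)
  first-of-cols = Val.cell j₀ 0 z≤n

  last-of-cols : Val.Fits (cell J₁ (suc n₀))
  last-of-cols = Val.cell (j₀ + b) n₀ ≤-refl

  InRows : ℕ → Set
  InRows p = suc k ≤ p × p ≤ p₁

  rows⇒InRows : ∀ {x} → InGrid x → RowFrom I₀ x → RowUpTo I₁ x → InRows (pos (element x))
  rows⇒InRows {x} gx from upTo = subst₂ _≤_ (+-comm k 1) (sym (pos≡code x)) (Pos.RowFrom⇒code≥ first-of-rows (fits-pos gx) from)
                               , subst (_≤ p₁) (sym (pos≡code x)) (Pos.RowUpTo⇒code≤ last-of-rows (fits-pos gx) upTo)

  InRows⇒rows : ∀ {x} → InGrid x → InRows (pos (element x)) → RowFrom I₀ x × RowUpTo I₁ x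
  InRows⇒rows {x} gx (lo , hi) = Pos.code≥⇒RowFrom first-of-rows (fits-pos gx) (subst₂ _≤_ (+-comm 1 k) (pos≡code x) lo)
                                , Pos.code≤⇒RowUpTo last-of-rows (fits-pos gx) (subst (_≤ p₁) (pos≡code x) hi)

  InBand : ℕ → Set
  InBand y = H⊢ J₀ ≤ y × y ≤ H⊣ J₁

  cols⇒band : ∀ {x} → InGrid x → RowFrom J₀ (transpose x) → RowUpTo J₁ (transpose x) →
              H⊢ J₀ ≤ h⊢ (element x) × h⊣ (element x) ≤ H⊣ J₁
  cols⇒band {x} gx from upTo =
      val≤⇒h⊢≤ (cell 0 j₀ z≤n (≤-trans (m≤m+n j₀ b) hb)) gx
        (subst (val (r 1 J₀) ≤_) (sym (val≡code x)) (Val.RowFrom⇒code≥ first-of-cols (fits-val gx) from))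
    , h⊣-mono (element x) (r (suc n₀) J₁)
        (subst (_≤ val (r (suc n₀) J₁)) (sym (val≡code x)) (Val.RowUpTo⇒code≤ last-of-cols (fits-val gx) upTo))

  band⇒cols : ∀ {x y} → InGrid x → InBand y → h⊢ (element x) ≤ y → y ≤ h⊣ (element x) →
              RowFrom J₀ (transpose x) × RowUpTo J₁ (transpose x)
  band⇒cols {x} gx (lo , hi) x≤y y≤x =
      Val.code≥⇒RowFrom first-of-cols (fits-val gx) (subst (val (r 1 J₀) ≤_) (val≡code x)
        (≮⇒≥ λ lt → <⇒≱ (val<⇒h⊣<h⊢ {x} (cell 0 j₀ z≤n (≤-trans (m≤m+n j₀ b) hb)) lt) (≤-trans lo y≤x)))
    , Val.code≤⇒RowUpTo last-of-cols (fits-val gx) (subst (_≤ val (r (suc n₀) J₁)) (val≡code x)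
        (≮⇒≥ λ lt → <⇒≱ (val<⇒h⊣<h⊢ {cell (suc n₀) J₁} gx lt) (≤-trans x≤y hi)))

  values : List Node → List ℕ
  values = concatMap (λ x → Sq (element x))

  Sq⊆block : ∀ {x} → InGrid x → Sq (element x) ⊆ block (pos (element x))
  Sq⊆block {x} gx = ∈⇒⊆-concatMap Sq (∈-filter⁺ (λ q → T? (pos q ≡ᵇ pos (element x))) (element∈entries gx) (≡⇒≡ᵇ (pos (element x)) _ refl))

  values-⊆ : ∀ {ch} → All InWindow ch → Linked _≺_ ch → values ch ⊆ within
  values-⊆ {ch} ws lk = concatMap-⊆-blocks (λ x → Sq (element x)) (λ x → pos (element x)) (suc k) l ch
    (Linked-map-All (λ gx gy → ≺⇒pos< gx gy) (All.map InWindow⇒InGrid ws) lk)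
    (All.map (λ {x} w → let lo , hi = rows⇒InRows (InWindow⇒InGrid w) (proj₁ (proj₁ w)) (proj₁ (proj₂ w))
                         in lo , s≤s (subst (pos (element x) ≤_) (sym k+l≡p₁) hi)) ws)
    (All.map (λ w → Sq⊆block (InWindow⇒InGrid w)) ws)

  values-increasing : ∀ {ch} → All InGrid ch → Linked _≺_ ch → Linked _<_ (values ch)
  values-increasing [] _ = []
  values-increasing {x ∷ ch} (gx ∷ gs) lk = Linked-++ (Sq-increasing (element x)) (values-increasing gs (Linked.tail lk)) separated
    where
    val-above : All (λ y → val (element x) < val (element y)) ch
    val-above = Linked-on⇒All (λ y → val (element y)) (Linked-map-All (λ gu gv → ≺⇒val< gu gv) (gx ∷ gs) lk)
    separated : ∀ {u v} → u ∈ Sq (element x) → v ∈ values ch → u < v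
    separated u∈ v∈ with x′ , x′∈ , v∈′ ← find (∈-concatMap⁻ (λ x → Sq (element x)) {xs = ch} v∈) =
      ≤-<-trans (Sq-upper gx u∈) (<-≤-trans (val<⇒h⊣<h⊢ {x} (All.lookup gs x′∈) (All.lookup val-above x′∈)) (Sq-lower {q = element x′} v∈′))

  values-banded : ∀ {ch} → All InWindow ch → Banded (H⊢ J₀) (H⊣ J₁) (values ch)
  values-banded ws = concat⁺ (map⁺ᴬ (All.map banded ws))
    where
    banded : ∀ {x} → InWindow x → All InBand (Sq (element x))
    banded {x} w with lo , hi ← cols⇒band (InWindow⇒InGrid w) (proj₂ (proj₁ w)) (proj₂ (proj₂ w)) =
      All.tabulate λ y∈ → ≤-trans lo (Sq-lower {q = element x} y∈) , ≤-trans (Sq-upper (InWindow⇒InGrid w) y∈) hi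

  wt≡w : ∀ x → wt (element x) ≡ w x
  wt≡w (cell i j) = refl
  wt≡w (diag i j) = refl

  length-values : ∀ ch → length (values ch) ≡ weight ch
  length-values ch = trans (length-concatMap _ ch) (cong sum (map-cong (λ x → trans (length-Sq (element x)) (wt≡w x)) ch))

  optimal : OptimalChain I₀ J₀ a b
  optimal = optimal-chain I₀ J₀ a b refl refl

  best : List Node
  best = cell I₀ J₀ ∷ proj₁ optimal

  best-chain : Linked _≺_ best
  best-chain = proj₁ (proj₂ optimal)

  best-window : All InWindow best
  best-window = All.zip (From-chain (≤-refl , ≤-refl) best-chain , proj₁ (proj₂ (proj₂ optimal)))

  best-weight : ℕ
  best-weight = weight best

  best-weight+dtw : best-weight + dtw I₀ J₀ a b ≡ suc (a + b) * cmax d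
  best-weight+dtw = proj₂ (proj₂ (proj₂ optimal))

  lis-witness : ∃[ xs ] (xs ⊆ within × Increasing xs × Banded (H⊢ J₀) (H⊣ J₁) xs × length xs ≡ best-weight)
  lis-witness = values best , values-⊆ best-window best-chain ,
                values-increasing (All.map InWindow⇒InGrid best-window) best-chain ,
                values-banded best-window , length-values best

  locate : ∀ {p y} → suc k ≤ p → p < suc k + l → y ∈ block p → InBand y →
           ∃[ x ] (InGrid x × InWindow x × pos (element x) ≡ p × y ∈ Sq (element x))
  locate {p} {y} lo hi y∈ band
    with q , q∈ , y∈Sq ← find (∈-concatMap⁻ Sq {xs = atPos p} y∈)
    with x , gx , refl ← ∈entries⇒ (proj₁ (∈-filter⁻ (λ q → T? (pos q ≡ᵇ p)) {xs = entries} q∈))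
    = x , gx , ((proj₁ rows , proj₁ cols) , (proj₂ rows , proj₂ cols)) , pos≡ , y∈Sq
    where
    pos≡ : pos (element x) ≡ p
    pos≡ = ≡ᵇ⇒≡ _ _ (proj₂ (∈-filter⁻ (λ q → T? (pos q ≡ᵇ p)) {xs = entries} q∈))
    rows : RowFrom I₀ x × RowUpTo I₁ x
    rows = InRows⇒rows gx (subst (suc k ≤_) (sym pos≡) lo , subst (_≤ p₁) (sym pos≡) (subst (p ≤_) k+l≡p₁ (≤-pred hi)))
    cols : RowFrom J₀ (transpose x) × RowUpTo J₁ (transpose x)
    cols = band⇒cols gx band (Sq-lower {q = element x} y∈Sq) (Sq-upper gx y∈Sq)

  -- The suffix y ∷ ys of an increasing banded subsequence, drawn from blocks at positions ≥ p,
  -- is covered by a chain whose first node holds y at the given offset.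
  record Cover (p y : ℕ) (ys : List ℕ) : Set where
    constructor cover
    field
      node   : Node
      rest   : List Node
      offset : ℕ
      grid   : InGrid node
      p≤pos  : p ≤ pos (element node)
      offset<wt : offset < wt (element node)
      y≡     : y ≡ h⊢ (element node) + offset
      chain  : Linked _≺_ (node ∷ rest)
      window : All InWindow (node ∷ rest)
      heavy  : suc (length ys) + offset ≤ weight (node ∷ rest)

  extend-cover : ∀ {p x o y y′ ys} → InGrid x → InWindow x → p ≤ pos (element x) → o < wt (element x) →
                 y ≡ h⊢ (element x) + o → y < y′ → Cover (pos (element x)) y′ ys → Cover p y (y′ ∷ ys)
  extend-cover {x = x} {o} {ys = ys} gx wx p≤ o< y≡ y<y′ (cover x′ ch o′ gx′ pos≤ o′< y′≡ lk ws heavy)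
    with m≤n⇒m<n∨m≡n pos≤
  ... | inj₂ e with refl ← element-pos-injective gx gx′ e = cover x ch o gx p≤ o< y≡ lk ws (begin
    suc (suc (length ys)) + o ≡⟨ +-suc (suc (length ys)) o ⟨
    suc (length ys) + suc o   ≤⟨ +-monoʳ-≤ (suc (length ys)) (+-cancelˡ-< (h⊢ (element x)) o o′ (subst₂ _<_ y≡ y′≡ y<y′)) ⟩
    suc (length ys) + o′      ≤⟨ heavy ⟩
    weight (x ∷ ch)           ∎)
    where open ≤-Reasoning
  ... | inj₁ pos< with <-cmp (val (element x)) (val (element x′))
  ...   | tri< val< _ _ = cover x (x′ ∷ ch) o gx p≤ o< y≡ (<²⇒≺ gx gx′ pos< val< ∷ lk) (wx ∷ ws) (begin
    suc (suc (length ys)) + o ≡⟨ +-comm (suc (suc (length ys))) o ⟩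
    o + suc (suc (length ys)) ≡⟨ +-suc o (suc (length ys)) ⟩
    suc o + suc (length ys)   ≤⟨ +-mono-≤ (subst (suc o ≤_) (wt≡w x) o<) (≤-trans (m≤m+n (suc (length ys)) o′) heavy) ⟩
    w x + weight (x′ ∷ ch)    ∎)
    where open ≤-Reasoning
  ...   | tri≈ _ val≡ _ = ⊥-elim (<-irrefl (cong (λ z → pos (element z)) (element-val-injective gx gx′ val≡)) pos<)
  ...   | tri> _ _ val> = ⊥-elim (<⇒≱ (val<⇒h⊣<h⊢ {x′} gx val>) (begin
    h⊢ (element x)      ≤⟨ m≤m+n _ o ⟩
    h⊢ (element x) + o  ≡⟨ y≡ ⟨
    _                   ≤⟨ <⇒≤ y<y′ ⟩
    _                   ≡⟨ y′≡ ⟩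
    h⊢ (element x′) + o′ ≤⟨ ∸+1+<≤ (wt≤h⊣ gx′) o′< ⟩
    h⊣ (element x′)     ∎))
    where open ≤-Reasoning

  covering : ∀ {p y ys} → Blockwise (suc k + l) p (y ∷ ys) → suc k ≤ p → Increasing (y ∷ ys) → All InBand (y ∷ ys) → Cover p y ys
  covering {ys = ys} (cons p≤p′ p′<hi y∈ bw) k<p inc (band ∷ bands)
    with x , gx , wx , refl , y∈Sq ← locate (≤-trans k<p p≤p′) p′<hi y∈ band
    with o , o< , y≡ ← ∈Sq⁻ {q = element x} y∈Sq
    with ys | bw
  ... | [] | _ = cover x [] o gx p≤p′ o< y≡ [-] (wx ∷ []) (≤-trans (subst (suc o ≤_) (wt≡w x) o<) (m≤m+n (w x) 0))
  ... | _ ∷ _ | bw′ = extend-cover gx wx p≤p′ o< y≡ (Linked.head inc)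
                        (covering bw′ (≤-trans k<p p≤p′) (Linked.tail inc) bands)

  lis-bound : ∀ xs → xs ⊆ within → Increasing xs → Banded (H⊢ J₀) (H⊣ J₁) xs → length xs ≤ best-weight
  lis-bound [] _ _ _ = z≤n
  lis-bound (y ∷ ys) sub inc bands
    with cover x ch o _ _ _ _ lk ws heavy ← covering (⊆⇒Blockwise (suc k) l (y ∷ ys) sub) ≤-refl inc bands
    = ≤-trans (≤-trans (m≤m+n (suc (length ys)) o) heavy) (+-cancelʳ-≤ (dtw I₀ J₀ a b) _ _ (begin
        weight (x ∷ ch) + dtw I₀ J₀ a b ≤⟨ chain-bound I₀ J₀ a b refl refl (x ∷ ch) lk (All.map proj₁ ws) (All.map proj₂ ws) ⟩
        suc (a + b) * cmax d            ≡⟨ best-weight+dtw ⟨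
        best-weight + dtw I₀ J₀ a b     ∎))
    where open ≤-Reasoning

  window-theorem : Σ[ D ∈ ℕ ] Σ[ L ∈ ℕ ]
                     (IsDTW (dis d) I₀ I₁ J₀ J₁ D
                     × IsBandedLIS (slice S (G⊢ I₀) (G⊣ I₁)) (H⊢ J₀) (H⊣ J₁) L
                     × D + L ≡ cmax d * ((suc I₁ ∸ I₀) + (suc J₁ ∸ J₀) ∸ 1))
  window-theorem = dtw I₀ J₀ a b , best-weight , dtw-isDTW I₀ J₀ a b ,
                   subst (λ T → IsBandedLIS T (H⊢ J₀) (H⊣ J₁) best-weight) (sym slice-rows) (lis-witness , lis-bound) ,
                   (begin
      dtw I₀ J₀ a b + best-weight                   ≡⟨ +-comm _ best-weight ⟩
      best-weight + dtw I₀ J₀ a b                   ≡⟨ best-weight+dtw ⟩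
      suc (a + b) * cmax d                          ≡⟨ *-comm (suc (a + b)) (cmax d) ⟩
      cmax d * suc (a + b)                          ≡⟨ cong (cmax d *_) lengths ⟨
      cmax d * ((suc I₁ ∸ I₀) + (suc J₁ ∸ J₀) ∸ 1) ∎)
    where
    open ≡-Reasoning
    length-window : ∀ u v → suc (u + v) ∸ u ≡ suc v
    length-window u v = trans (cong (_∸ u) (sym (+-suc u v))) (m+n∸m≡n u (suc v))
    lengths : (suc I₁ ∸ I₀) + (suc J₁ ∸ J₀) ∸ 1 ≡ suc (a + b)
    lengths = trans (cong₂ (λ u v → u + v ∸ 1) (length-window i₀ a) (length-window j₀ b)) (+-suc a b)

theorem2 : (n m : ℕ) → 1 ≤ n → 1 ≤ m → (d : Fin n → Fin m → ℕ) →
  (i⊢ i⊣ j⊢ j⊣ : ℕ) → 1 ≤ i⊢ → i⊢ ≤ i⊣ → i⊣ ≤ n → 1 ≤ j⊢ → j⊢ ≤ j⊣ → j⊣ ≤ m →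
  Σ[ D ∈ ℕ ] Σ[ L ∈ ℕ ]
    (IsDTW (dis d) i⊢ i⊣ j⊢ j⊣ D
    × IsBandedLIS (slice (Aux.S d) (Aux.G⊢ d i⊢) (Aux.G⊣ d i⊣))
                  (Aux.H⊢ d j⊢) (Aux.H⊣ d j⊣) L
    × D + L ≡ cmax d * ((suc i⊣ ∸ i⊢) + (suc j⊣ ∸ j⊢) ∸ 1))
theorem2 (suc n₀) (suc m₀) _ _ d (suc i₀) i⊣ (suc j₀) j⊣ _ i⊢≤i⊣ i⊣≤n _ j⊢≤j⊣ j⊣≤m
  with a , refl ← m≤n⇒∃[o]m+o≡n i⊢≤i⊣ | b , refl ← m≤n⇒∃[o]m+o≡n j⊢≤j⊣
  = Window.window-theorem d i₀ a j₀ b (s≤s⁻¹ i⊣≤n) (s≤s⁻¹ j⊣≤m)
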